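{- Let $q$ be a prime power, let $f\in\mathbb F_q[x]$ be an irreducible polynomial of degree $k$ and order $e$, and let $n$ be a positive integer with $\gcd(n,q)=1$, $\gcd(n,ek)=1$, $s_n>1$ and $\gcd(s_n,k)=1$. Let $d=\gcd(n,q^{s_n}-1)$, $m=n/d$, let $r$ be a positive integer with $rn\equiv1\pmod e$, let $\alpha$ be a root of $f$, and let $\theta\in\mathbb F_{q^{s_n}}^*$ have multiplicative order $d$. For a positive divisor $t$ of $m$ and an integer $1\le u\le d$ with $\gcd(u,t)=1$, let $$G_{t,u}(x)=\prod_{i=0}^{k-1}\bigl(x^t-\theta^{ -u}\alpha^{trq^{is_n}}\bigr)\in\mathbb F_{q^{s_n}}[x],$$ and let $l_{t,u}$ be the least positive integer $v$ such that $G_{t,u}(x)\in\mathbb F_{q^v}[x]$. Then $l_{t,u}$ is the least positive integer $v$ such that $\dfrac{\gcd(n,q^{s_n}-1)}{\gcd(n,q^v-1)}$ (is an integer that) divides $u$.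
   Context: For a positive integer $n$ with $\gcd(n,q)=1$, let $\mathrm{rad}(n)$ be the product of the distinct primes dividing $n$ and $S_n=\mathrm{ord}_{\mathrm{rad}(n)}q$ (multiplicative order of $q$ modulo $\mathrm{rad}(n)$). Define $s_n=2S_n$ if both $q^{S_n}\equiv3\pmod4$ and $8\mid n$, and $s_n=S_n$ otherwise. The order of a polynomial $f$ with $f(0)\ne0$ is the least positive integer $e$ with $f(x)\mid x^e-1$. -}

module Defs where

open import Level using (Level; _⊔_)
open import Algebra.Bundles using (CommutativeRing)
open import Data.Nat as ℕ using (ℕ; zero; suc; _≤_; _<_; _∸_)
open import Data.Nat.Divisibility using (_∣_; _∣?_)
open import Data.Nat.Primality using (Prime; prime?)
open import Data.List using (List; []; _∷_; [_]; _++_; replicate; foldr; map; upTo; filter)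
open import Data.Nat.ListAction using (product)
open import Data.Fin using (Fin)
open import Data.Product using (Σ; ∃; _×_; _,_)
open import Data.Sum using (_⊎_)
open import Relation.Nullary using (¬_)
open import Relation.Nullary.Decidable using (_×-dec_)
open import Relation.Binary.PropositionalEquality using (_≡_)

rad : ℕ → ℕ
rad n = product (filter (λ p → prime? p ×-dec (p ∣? n)) (upTo (suc n)))

IsLeastPos : {a : Level} → (ℕ → Set a) → ℕ → Set a
IsLeastPos P v = 0 < v × P v × (∀ w → 0 < w → P w → v ≤ w)

IsOrdMod : ℕ → ℕ → ℕ → Set
IsOrdMod r q = IsLeastPos (λ e → r ∣ (q ℕ.^ e ∸ 1))

IsSn : ℕ → ℕ → ℕ → Set
IsSn q n S = IsOrdMod (rad n) q S

Is-sn : ℕ → ℕ → ℕ → Set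
Is-sn q n s = Σ ℕ λ S → IsSn q n S
  × ((q ℕ.^ S ℕ.% 4 ≡ 3 × 8 ∣ n) → s ≡ 2 ℕ.* S)
  × (¬ (q ℕ.^ S ℕ.% 4 ≡ 3 × 8 ∣ n) → s ≡ S)

module _ {c ℓ : Level} (R : CommutativeRing c ℓ) where
  open CommutativeRing R

  IsField : Set (c ⊔ ℓ)
  IsField = ¬ (0# ≈ 1#) × (∀ x → ¬ (x ≈ 0#) → ∃ λ y → x * y ≈ 1#)

  HasCard : ℕ → Set (c ⊔ ℓ)
  HasCard N = Σ (Fin N → Carrier) λ g →
    (∀ i j → g i ≈ g j → i ≡ j) × (∀ x → ∃ λ i → g i ≈ x)

  infixr 8 _^'_
  _^'_ : Carrier → ℕ → Carrier
  x ^' zero = 1#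
  x ^' suc n = x * (x ^' n)

  IsMulOrd : Carrier → ℕ → Set ℓ
  IsMulOrd x = IsLeastPos (λ e → x ^' e ≈ 1#)

  -- x lies in F_{q^v} = { y | y^{q^v} = y }
  InF : ℕ → Carrier → Set ℓ
  InF Q x = x ^' Q ≈ x

  -- polynomials as coefficient lists, lowest degree first
  Poly : Set c
  Poly = List Carrier

  coeff : Poly → ℕ → Carrier
  coeff [] _ = 0#
  coeff (a ∷ p) zero = a
  coeff (a ∷ p) (suc i) = coeff p i

  -- equality of polynomials (ignores trailing zeros)
  _≈ₚ_ : Poly → Poly → Set ℓ
  p ≈ₚ p' = ∀ i → coeff p i ≈ coeff p' i

  _+ₚ_ : Poly → Poly → Poly
  [] +ₚ p' = p'
  (a ∷ p) +ₚ [] = a ∷ p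
  (a ∷ p) +ₚ (b ∷ p') = (a + b) ∷ (p +ₚ p')

  scale : Carrier → Poly → Poly
  scale a = map (a *_)

  negₚ : Poly → Poly
  negₚ = map (-_)

  _-ₚ_ : Poly → Poly → Poly
  p -ₚ p' = p +ₚ negₚ p'

  _*ₚ_ : Poly → Poly → Poly
  [] *ₚ p' = []
  (a ∷ p) *ₚ p' = scale a p' +ₚ (0# ∷ (p *ₚ p'))

  oneₚ : Poly
  oneₚ = [ 1# ]

  const : Carrier → Poly
  const a = [ a ]

  xpow : ℕ → Poly
  xpow t = replicate t 0# ++ [ 1# ]

  eval : Poly → Carrier → Carrier
  eval [] y = 0#
  eval (a ∷ p) y = a + y * eval p y

  HasDegree : Poly → ℕ → Set ℓ
  HasDegree p k = ¬ (coeff p k ≈ 0#) × (∀ i → k < i → coeff p i ≈ 0#)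

  PolyOver : ℕ → Poly → Set ℓ
  PolyOver Q p = ∀ i → InF Q (coeff p i)

  DividesOver : ℕ → Poly → Poly → Set (c ⊔ ℓ)
  DividesOver Q f g = ∃ λ h → PolyOver Q h × g ≈ₚ (f *ₚ h)

  IrreducibleOver : ℕ → Poly → Set (c ⊔ ℓ)
  IrreducibleOver Q f = PolyOver Q f × (∃ λ k → 0 < k × HasDegree f k)
    × (∀ g h → PolyOver Q g → PolyOver Q h → f ≈ₚ (g *ₚ h) →
         HasDegree g 0 ⊎ HasDegree h 0)

  IsPolyOrder : ℕ → Poly → ℕ → Set (c ⊔ ℓ)
  IsPolyOrder Q f = IsLeastPos (λ e → DividesOver Q f (xpow e -ₚ oneₚ))

  prodₚ : ℕ → (ℕ → Poly) → Poly
  prodₚ k F = foldr (λ i acc → F i *ₚ acc) oneₚ (upTo k)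

  Gtu : (q s k r t u : ℕ) (α θ⁻¹ : Carrier) → Poly
  Gtu q s k r t u α θ⁻¹ =
    prodₚ k (λ i → xpow t -ₚ const ((θ⁻¹ ^' u) * (α ^' (t ℕ.* r ℕ.* q ℕ.^ (i ℕ.* s)))))

  IsRoot : Poly → Carrier → Set ℓ
  IsRoot f x = eval f x ≈ 0#

  IsInverse : Carrier → Carrier → Set ℓ
  IsInverse x y = x * y ≈ 1#

{-# OPTIONS --safe #-}
-- Write G = ∏ᵢ (xᵗ - βᵢ) with βᵢ = θ⁻ᵘ α^(t r q^(i s)), so G(x) = H(xᵗ) for H = ∏ᵢ (x - βᵢ).
-- If G has coefficients in F_{q^w}, so does H, hence the Frobenius map φ = (_^ q^w) sends the
-- root β₀ of H to some βᵢ; raising to the e-th power removes α (as αᵉ = 1) and leaves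
-- θ^(-u e (q^w - 1)) = 1, so d ∣ u (q^w - 1) because gcd(d, e) = 1.
-- Conversely, if d ∣ u (q^w - 1) then φ fixes θ⁻ᵘ and maps βᵢ to β_{i+c}, where c s ≡ w (mod k)
-- (gcd(s, k) = 1); this uses α^(q^k) = α, which holds because the Frobenius orbit of a root
-- of the irreducible f has exactly deg f elements. So φ permutes the factors of G.
-- Finally, the least w with d ∣ u (q^w - 1) divides s, hence gcd(n, q^w - 1) divides d, and
-- the cofactor d / gcd(n, q^w - 1) divides u.
module Submission where

open import Level using (Level)
open import Algebra.Bundles using (CommutativeRing)
open import Algebra.Morphism.Structures using (module RingMorphisms)
open import Data.Nat as ℕ using (ℕ; zero; suc; _≤_; _<_; NonZero)
import Data.Nat.Properties as ℕP
open import Data.Nat.Induction using (<-rec)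
open import Data.Nat.Divisibility
  using (_∣_; divides; _∣?_; ∣-trans; ∣-refl; _∣0; *-pres-∣; ∣n⇒∣m*n; ∣m∣n⇒∣m+n; ∣m+n∣m⇒∣n; m%n≡0⇒n∣m; ∣⇒≤; m*n∣o⇒m∣o/n; ∣m⇒∣m*n; ∣1⇒≡1)
open import Data.Nat.DivMod using (_%_; _/_; m≡m%n+[m/n]*n; m%n<n; m/n*n≡m; *-/-assoc)
open import Data.Nat.GCD using (gcd; gcd[m,n]∣m; gcd[m,n]∣n; gcd-greatest; gcd[m,n]≢0; module Bézout)
open import Data.Nat.Coprimality using (Coprime; coprime-factors; coprime-/gcd; coprime-Bézout; coprime-divisor; gcd≡1⇒coprime)
open import Data.Nat.Primality using (Prime; euclidsLemma; prime⇒nonZero)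
open import Data.Nat.Combinatorics using (_C_; nC1≡n; nCn≡1; nCk+nC[k+1]≡[n+1]C[k+1])
open import Data.Nat.Solver using (module +-*-Solver)
open import Data.Fin as Fin using (Fin; toℕ)
import Data.Fin.Properties as FinP
open import Data.Fin.Permutation using (permutation)
open import Data.Vec.Functional using (init; last)
open import Data.List using ([]; _∷_; _++_; replicate; foldr; map; applyUpTo)
open import Data.Product using (∃; _×_; _,_; proj₁; proj₂)
open import Data.Sum using (_⊎_; inj₁; inj₂)
open import Data.Empty using (⊥-elim)
open import Function using (_∘_)
open import Function.Bundles using (_⇔_; mk⇔; module Equivalence)
open import Function.Properties.Equivalence using () renaming (sym to ⇔-sym; trans to ⇔-trans)
open import Relation.Nullary using (¬_; Dec; yes; no; contradiction)
open import Relation.Nullary.Decidable using (_×-dec_)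
open import Relation.Unary using (Decidable)
open import Relation.Binary.Bundles using (Setoid)
open import Relation.Binary.Definitions using (tri<; tri≈; tri>)
open import Relation.Binary.PropositionalEquality as ≡ using (_≡_)
import Relation.Binary.Reasoning.Setoid as SetoidReasoning

open import Defs
  using (IsLeastPos; Is-sn; IsMulOrd; IsInverse; IsPolyOrder; IsField; HasCard; _^'_; InF; PolyOver; Poly; coeff; const; xpow; eval; prodₚ; oneₚ; scale; negₚ;
         IrreducibleOver; HasDegree; IsRoot; Gtu)
import Defs as D

module Arithmetic where
  open import Data.Nat using (_+_; _*_; _∸_; _^_; _<?_; pred)
  open +-*-Solver using (solve; _:+_; _:*_; con; _:=_)
  open ≡ using (refl; cong; cong₂; sym; subst)

  module _ {ℓ : Level} {P : ℕ → Set ℓ} where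

    leastPos-exists : Decidable P → ∀ {v} → 0 < v → P v → ∃ (IsLeastPos P)
    leastPos-exists P? = <-rec _ search _
      where
        search : ∀ v → (∀ {w} → w < v → 0 < w → P w → ∃ (IsLeastPos P)) → 0 < v → P v → ∃ (IsLeastPos P)
        search v smaller 0<v Pv with ℕP.anyUpTo? (λ w → (0 <? w) ×-dec P? w) v
        ... | yes (w , w<v , 0<w , Pw) = smaller w<v 0<w Pw
        ... | no none = v , 0<v , Pv , λ w 0<w Pw → ℕP.≮⇒≥ λ w<v → none (w , w<v , 0<w , Pw)

    leastPos-divides : (∀ x y → P (x + y) → P x → P y) → (∀ m x → P x → P (m * x)) →
                       ∀ {l w} → IsLeastPos P l → P w → l ∣ w
    leastPos-divides P-sub P-mul {l} {w} (0<l , Pl , minimal) Pw = m%n≡0⇒n∣m w l w%l≡0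
      where
        instance _ = ℕ.>-nonZero 0<l
        w%l≡0 : w % l ≡ 0
        w%l≡0 with w % l | m%n<n w l
               | P-sub (w / l * l) (w % l) (subst P (≡.trans (m≡m%n+[m/n]*n w l) (ℕP.+-comm (w % l) _)) Pw) (P-mul (w / l) l Pl)
        ... | zero  | _   | _   = refl
        ... | suc r | r<l | Pr = ⊥-elim (ℕP.<⇒≱ r<l (minimal (suc r) (ℕ.s≤s ℕ.z≤n) Pr))

  leastPos-cong : ∀ {a b} {A : ℕ → Set a} {B : ℕ → Set b} →
                  (∀ w → 0 < w → A w ⇔ B w) → ∀ v → IsLeastPos A v ⇔ IsLeastPos B v
  leastPos-cong A⇔B v = mk⇔ (transfer A⇔B) (transfer λ w 0<w → ⇔-sym (A⇔B w 0<w))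
    where
      transfer : ∀ {a b} {A : ℕ → Set a} {B : ℕ → Set b} →
                 (∀ w → 0 < w → A w ⇔ B w) → IsLeastPos A v → IsLeastPos B v
      transfer A⇔B (0<v , Av , minimal) =
        0<v , Equivalence.to (A⇔B v 0<v) Av , λ w 0<w Bw → minimal w 0<w (Equivalence.from (A⇔B w 0<w) Bw)

  module _ {a b} {P : ℕ → Set a} {Q : ℕ → Set b} (P? : Decidable P)
           (Q⇒P : ∀ {w} → Q w → P w) (leastP⇒Q : ∀ {l} → IsLeastPos P l → Q l) where

    leastPos-⇔ : ∀ v → IsLeastPos P v ⇔ IsLeastPos Q v
    leastPos-⇔ v = mk⇔ to from
      where
        to : IsLeastPos P v → IsLeastPos Q v
        to least@(0<v , _ , minimal) = 0<v , leastP⇒Q least , λ w 0<w Qw → minimal w 0<w (Q⇒P Qw)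
        from : IsLeastPos Q v → IsLeastPos P v
        from (0<v , Qv , minimal) = 0<v , Q⇒P Qv , λ w 0<w Pw →
          let l , least@(0<l , _ , l-minimal) = leastPos-exists P? 0<w Pw
          in ℕP.≤-trans (minimal l 0<l (leastP⇒Q least)) (l-minimal w 0<w Pw)

  [1+n]C[1+k]*[1+k]≡[1+n]*nCk : ∀ n k → (suc n C suc k) * suc k ≡ suc n * (n C k)
  [1+n]C[1+k]*[1+k]≡[1+n]*nCk zero    zero    = refl
  [1+n]C[1+k]*[1+k]≡[1+n]*nCk zero    (suc k) = refl
  [1+n]C[1+k]*[1+k]≡[1+n]*nCk (suc n) zero    =
    ≡.trans (ℕP.*-identityʳ (suc (suc n) C 1)) (≡.trans (nC1≡n (suc (suc n))) (sym (ℕP.*-identityʳ (suc (suc n)))))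
  [1+n]C[1+k]*[1+k]≡[1+n]*nCk (suc n) (suc k) = begin
    (2+n C 2+k) * 2+k                               ≡⟨ cong (_* 2+k) (sym (nCk+nC[k+1]≡[n+1]C[k+1] (suc n) (suc k))) ⟩
    ((1+n C 1+k) + (1+n C 2+k)) * 2+k               ≡⟨ ℕP.*-distribʳ-+ 2+k (1+n C 1+k) (1+n C 2+k) ⟩
    (1+n C 1+k) * 2+k + (1+n C 2+k) * 2+k           ≡⟨ cong₂ _+_ (ℕP.*-suc (1+n C 1+k) (suc k)) ([1+n]C[1+k]*[1+k]≡[1+n]*nCk n (suc k)) ⟩
    (1+n C 1+k) + (1+n C 1+k) * 1+k + 1+n * (n C 1+k) ≡⟨ cong (λ z → (1+n C 1+k) + z + 1+n * (n C 1+k)) ([1+n]C[1+k]*[1+k]≡[1+n]*nCk n k) ⟩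
    (1+n C 1+k) + 1+n * (n C k) + 1+n * (n C 1+k)   ≡⟨ ℕP.+-assoc (1+n C 1+k) _ _ ⟩
    (1+n C 1+k) + (1+n * (n C k) + 1+n * (n C 1+k)) ≡⟨ cong ((1+n C 1+k) +_) (sym (ℕP.*-distribˡ-+ 1+n (n C k) (n C 1+k))) ⟩
    (1+n C 1+k) + 1+n * ((n C k) + (n C 1+k))       ≡⟨ cong (λ z → (1+n C 1+k) + 1+n * z) (nCk+nC[k+1]≡[n+1]C[k+1] n k) ⟩
    (1+n C 1+k) + 1+n * (1+n C 1+k)                 ∎
    where
      open ≡.≡-Reasoning
      1+n = suc n; 2+n = suc (suc n); 1+k = suc k; 2+k = suc (suc k)

  prime∣pCk : ∀ {p k} → Prime p → 0 < k → k < p → p ∣ p C k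
  prime∣pCk {suc n} {suc k} p-prime _ k<p
    with euclidsLemma (suc n C suc k) (suc k) p-prime
           (divides (n C k) (≡.trans ([1+n]C[1+k]*[1+k]≡[1+n]*nCk n k) (ℕP.*-comm (suc n) (n C k))))
  ... | inj₁ p∣pCk  = p∣pCk
  ... | inj₂ p∣1+k = ⊥-elim (ℕP.<⇒≱ k<p (∣⇒≤ p∣1+k))

  ^-+-∸1 : ∀ q x y .{{_ : NonZero q}} → q ^ (x + y) ∸ 1 ≡ q ^ y * (q ^ x ∸ 1) + (q ^ y ∸ 1)
  ^-+-∸1 q x y = begin
    q ^ (x + y) ∸ 1                       ≡⟨ cong (_∸ 1) (ℕP.^-distribˡ-+-* q x y) ⟩
    q ^ x * q ^ y ∸ 1                     ≡⟨ cong₂ (λ a b → a * b ∸ 1) (sym (ℕP.suc-pred (q ^ x))) (sym (ℕP.suc-pred (q ^ y))) ⟩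
    suc (pred (q ^ x)) * suc (pred (q ^ y)) ∸ 1 ≡⟨ solve 2 (λ a b → b :+ a :* (con 1 :+ b) := (con 1 :+ b) :* a :+ b) refl (pred (q ^ x)) (pred (q ^ y)) ⟩
    suc (pred (q ^ y)) * pred (q ^ x) + pred (q ^ y) ≡⟨ cong (λ b → b * pred (q ^ x) + pred (q ^ y)) (ℕP.suc-pred (q ^ y)) ⟩
    q ^ y * (q ^ x ∸ 1) + (q ^ y ∸ 1)     ∎
    where
      open ≡.≡-Reasoning
      instance _ = ℕP.m^n≢0 q x
      instance _ = ℕP.m^n≢0 q y

  q^x∸1∣q^[m*x]∸1 : ∀ q x m .{{_ : NonZero q}} → (q ^ x ∸ 1) ∣ (q ^ (m * x) ∸ 1)
  q^x∸1∣q^[m*x]∸1 q x zero    = _ ∣0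
  q^x∸1∣q^[m*x]∸1 q x (suc m) = subst ((q ^ x ∸ 1) ∣_) (sym (^-+-∸1 q x (m * x)))
    (∣m∣n⇒∣m+n (∣n⇒∣m*n (q ^ (m * x)) ∣-refl) (q^x∸1∣q^[m*x]∸1 q x m))

  module GcdCriterion (n q s d u : ℕ) .{{_ : NonZero q}} (0<n : 0 < n) (d≡ : d ≡ gcd n (q ^ s ∸ 1)) where

    Div : ℕ → Set
    Div w = d ∣ u * (q ^ w ∸ 1)

    GcdForm : ℕ → Set
    GcdForm w = ∃ λ c → d ≡ c * gcd n (q ^ w ∸ 1) × c ∣ u

    Div? : Decidable Div
    Div? w = d ∣? (u * (q ^ w ∸ 1))

    u*[q^[x+y]∸1]≡ : ∀ x y → u * (q ^ (x + y) ∸ 1) ≡ q ^ y * (u * (q ^ x ∸ 1)) + u * (q ^ y ∸ 1)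
    u*[q^[x+y]∸1]≡ x y = begin
      u * (q ^ (x + y) ∸ 1)                           ≡⟨ cong (u *_) (^-+-∸1 q x y) ⟩
      u * (q ^ y * (q ^ x ∸ 1) + (q ^ y ∸ 1))         ≡⟨ solve 4 (λ u a b c → u :* (a :* b :+ c) := a :* (u :* b) :+ u :* c) refl u (q ^ y) (q ^ x ∸ 1) (q ^ y ∸ 1) ⟩
      q ^ y * (u * (q ^ x ∸ 1)) + u * (q ^ y ∸ 1)     ∎
      where open ≡.≡-Reasoning

    Div-sub : ∀ x y → Div (x + y) → Div x → Div y
    Div-sub x y Dx+y Dx = ∣m+n∣m⇒∣n (subst (d ∣_) (u*[q^[x+y]∸1]≡ x y) Dx+y) (∣n⇒∣m*n (q ^ y) Dx)

    Div-mul : ∀ m x → Div x → Div (m * x)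
    Div-mul m x Dx = ∣-trans Dx (*-pres-∣ (∣-refl {u}) (q^x∸1∣q^[m*x]∸1 q x m))

    d∣n : d ∣ n
    d∣n = subst (_∣ n) (sym d≡) (gcd[m,n]∣m n _)

    Div-s : Div s
    Div-s = ∣n⇒∣m*n u (subst (_∣ (q ^ s ∸ 1)) (sym d≡) (gcd[m,n]∣n n (q ^ s ∸ 1)))

    GcdForm⇒Div : ∀ {w} → GcdForm w → Div w
    GcdForm⇒Div {w} (c , d≡c*g , c∣u) = subst (_∣ u * (q ^ w ∸ 1)) (sym d≡c*g) (*-pres-∣ c∣u (gcd[m,n]∣n n (q ^ w ∸ 1)))

    -- The least solution l of Div divides s, so gcd n (q ^ l ∸ 1) divides d, and the cofactor
    -- of d, being coprime to (q ^ l ∸ 1) / gcd, must divide u.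
    leastDiv⇒GcdForm : ∀ {l} → IsLeastPos Div l → GcdForm l
    leastDiv⇒GcdForm {l} least = c , sym (m/n*n≡m g∣d) , c∣u
      where
        Y = q ^ l ∸ 1
        g = gcd n Y
        instance _ = ℕ.≢-nonZero (gcd[m,n]≢0 n Y (inj₁ λ n≡0 → ℕP.<⇒≢ 0<n (sym n≡0)))
        Y∣q^s∸1 : Y ∣ q ^ s ∸ 1
        Y∣q^s∸1 with leastPos-divides {P = Div} Div-sub Div-mul {w = s} least Div-s
        ... | divides m s≡m*l = subst (λ z → Y ∣ q ^ z ∸ 1) (sym s≡m*l) (q^x∸1∣q^[m*x]∸1 q l m)
        g∣d : g ∣ d
        g∣d = subst (g ∣_) (sym d≡) (gcd-greatest (gcd[m,n]∣m n Y) (∣-trans (gcd[m,n]∣n n Y) Y∣q^s∸1))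
        c = d / g
        c*g∣ : ∀ {o} → d ∣ o → c * g ∣ o
        c*g∣ = subst (_∣ _) (sym (m/n*n≡m g∣d))
        c∣n/g : c ∣ n / g
        c∣n/g = m*n∣o⇒m∣o/n c g (c*g∣ d∣n)
        c∣Y/g*u : c ∣ Y / g * u
        c∣Y/g*u = subst (c ∣_) (≡.trans (*-/-assoc u (gcd[m,n]∣n n Y)) (ℕP.*-comm u (Y / g)))
                    (m*n∣o⇒m∣o/n c g (c*g∣ (proj₁ (proj₂ least))))
        c∣u : c ∣ u
        c∣u = coprime-factors (coprime-/gcd n Y) (∣-trans c∣n/g (∣m⇒∣m*n u ∣-refl) , c∣Y/g*u)

    leastDiv⇔leastGcdForm : ∀ v → IsLeastPos Div v ⇔ IsLeastPos GcdForm v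
    leastDiv⇔leastGcdForm = leastPos-⇔ {P = Div} {Q = GcdForm} Div? (λ {w} → GcdForm⇒Div {w}) (λ {l} → leastDiv⇒GcdForm {l})

  coprime⇒shift : ∀ {s k} → Coprime s k → 0 < k → ∀ w → ∃ λ c → ∃ λ j → ∃ λ j′ → c * s + k * j ≡ w + k * j′
  coprime⇒shift {s} {k} s⊥k 0<k w with coprime-Bézout s⊥k
  ... | Bézout.+- x y 1+y*k≡x*s = x * w , 0 , y * w , (begin
    x * w * s + k * 0      ≡⟨ solve 4 (λ x w s k → x :* w :* s :+ k :* con 0 := (x :* s) :* w) refl x w s k ⟩
    (x * s) * w            ≡⟨ cong (_* w) (sym 1+y*k≡x*s) ⟩
    (1 + y * k) * w        ≡⟨ solve 3 (λ y k w → (con 1 :+ y :* k) :* w := w :+ k :* (y :* w)) refl y k w ⟩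
    w + k * (y * w)        ∎)
    where open ≡.≡-Reasoning
  ... | Bézout.-+ x y 1+x*s≡y*k = x * w * k′ , w , y * w * k′ , (begin
    x * w * k′ * s + k * w              ≡⟨ cong (λ k → x * w * k′ * s + k * w) k≡1+k′ ⟩
    x * w * k′ * s + suc k′ * w         ≡⟨ solve 4 (λ x w k′ s → x :* w :* k′ :* s :+ (con 1 :+ k′) :* w := k′ :* w :* (con 1 :+ x :* s) :+ w) refl x w k′ s ⟩
    k′ * w * (1 + x * s) + w            ≡⟨ cong (λ z → k′ * w * z + w) 1+x*s≡y*k ⟩
    k′ * w * (y * k) + w                ≡⟨ solve 4 (λ k′ w y k → k′ :* w :* (y :* k) :+ w := w :+ k :* (y :* w :* k′)) refl k′ w y k ⟩
    w + k * (y * w * k′)                ∎)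
    where
      open ≡.≡-Reasoning
      k′ = pred k
      k≡1+k′ : k ≡ suc k′
      k≡1+k′ = sym (ℕP.suc-pred k {{ℕ.>-nonZero 0<k}})

open Arithmetic

module Polynomial {c ℓ} (R : CommutativeRing c ℓ) where

  open CommutativeRing R hiding (zero)
  open import Algebra.Properties.Ring ring using (-‿distribʳ-*; -0#≈0#; -1*x≈-x)
  open import Algebra.Properties.AbelianGroup +-abelianGroup using (⁻¹-∙-comm)
  open import Algebra.Properties.Group +-group using (x∙y⁻¹≈ε⇒x≈y; ⁻¹-involutive)
  open RingMorphisms rawRing rawRing using (IsRingHomomorphism)

  infixl 6 _+ₚ_ _-ₚ_
  infixl 7 _*ₚ_
  _+ₚ_ _-ₚ_ _*ₚ_ : Poly R → Poly R → Poly R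
  _+ₚ_ = D._+ₚ_ R
  _-ₚ_ = D._-ₚ_ R
  _*ₚ_ = D._*ₚ_ R

  -- A record wrapper around Defs._≈ₚ_, so that the compared polynomials can be inferred.
  infix 4 _≋_
  record _≋_ (p p′ : Poly R) : Set ℓ where
    constructor mk≋
    field coeff-≈ : ∀ i → coeff R p i ≈ coeff R p′ i
  open _≋_ public

  ≋-refl : ∀ {p} → p ≋ p
  ≋-refl = mk≋ λ _ → refl

  ≋-sym : ∀ {p p′} → p ≋ p′ → p′ ≋ p
  ≋-sym e = mk≋ λ i → sym (coeff-≈ e i)

  ≋-trans : ∀ {p p′ p″} → p ≋ p′ → p′ ≋ p″ → p ≋ p″
  ≋-trans e e′ = mk≋ λ i → trans (coeff-≈ e i) (coeff-≈ e′ i)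

  ≋-reflexive : ∀ {p p′} → p ≡ p′ → p ≋ p′
  ≋-reflexive ≡.refl = ≋-refl

  ≋-setoid : Setoid c ℓ
  ≋-setoid = record
    { Carrier = Poly R ; _≈_ = _≋_
    ; isEquivalence = record { refl = ≋-refl ; sym = ≋-sym ; trans = ≋-trans } }

  module ≋-Reasoning = SetoidReasoning ≋-setoid

  ∷-cong : ∀ {a b p p′} → a ≈ b → p ≋ p′ → (a ∷ p) ≋ (b ∷ p′)
  ∷-cong a≈b e = mk≋ λ { zero → a≈b ; (suc i) → coeff-≈ e i }

  ∷-injectiveˡ : ∀ {a b p p′} → (a ∷ p) ≋ (b ∷ p′) → a ≈ b
  ∷-injectiveˡ e = coeff-≈ e 0

  ∷-injectiveʳ : ∀ {a b p p′} → (a ∷ p) ≋ (b ∷ p′) → p ≋ p′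
  ∷-injectiveʳ e = mk≋ λ i → coeff-≈ e (suc i)

  ∷-≋[] : ∀ {a p} → a ≈ 0# → p ≋ [] → (a ∷ p) ≋ []
  ∷-≋[] a≈0 e = mk≋ λ { zero → a≈0 ; (suc i) → coeff-≈ e i }

  ≋[]-head : ∀ {a p} → (a ∷ p) ≋ [] → a ≈ 0#
  ≋[]-head e = coeff-≈ e 0

  ≋[]-tail : ∀ {a p} → (a ∷ p) ≋ [] → p ≋ []
  ≋[]-tail e = mk≋ λ i → coeff-≈ e (suc i)

  module _ where
    open SetoidReasoning setoid

    coeff-+ₚ : ∀ p p′ i → coeff R (p +ₚ p′) i ≈ coeff R p i + coeff R p′ i
    coeff-+ₚ []      p′       i       = sym (+-identityˡ _)
    coeff-+ₚ (a ∷ p) []       i       = sym (+-identityʳ _)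
    coeff-+ₚ (a ∷ p) (b ∷ p′) zero    = refl
    coeff-+ₚ (a ∷ p) (b ∷ p′) (suc i) = coeff-+ₚ p p′ i

    coeff-scale : ∀ a p i → coeff R (scale R a p) i ≈ a * coeff R p i
    coeff-scale a []      i       = sym (zeroʳ a)
    coeff-scale a (b ∷ p) zero    = refl
    coeff-scale a (b ∷ p) (suc i) = coeff-scale a p i

    coeff-negₚ : ∀ p i → coeff R (negₚ R p) i ≈ - coeff R p i
    coeff-negₚ []      i       = sym -0#≈0#
    coeff-negₚ (b ∷ p) zero    = refl
    coeff-negₚ (b ∷ p) (suc i) = coeff-negₚ p i

    coeff--ₚ : ∀ p p′ i → coeff R (p -ₚ p′) i ≈ coeff R p i - coeff R p′ i
    coeff--ₚ p p′ i = trans (coeff-+ₚ p (negₚ R p′) i) (+-congˡ (coeff-negₚ p′ i))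

    +ₚ-cong : ∀ {p p′ r r′} → p ≋ p′ → r ≋ r′ → p +ₚ r ≋ p′ +ₚ r′
    +ₚ-cong {p} {p′} {r} {r′} e e′ = mk≋ λ i →
      trans (coeff-+ₚ p r i) (trans (+-cong (coeff-≈ e i) (coeff-≈ e′ i)) (sym (coeff-+ₚ p′ r′ i)))

    +ₚ-congˡ : ∀ p {r r′} → r ≋ r′ → p +ₚ r ≋ p +ₚ r′
    +ₚ-congˡ p = +ₚ-cong (≋-refl {p})

    +ₚ-comm : ∀ p r → p +ₚ r ≋ r +ₚ p
    +ₚ-comm p r = mk≋ λ i → trans (coeff-+ₚ p r i) (trans (+-comm _ _) (sym (coeff-+ₚ r p i)))

    +ₚ-assoc : ∀ p r r′ → (p +ₚ r) +ₚ r′ ≋ p +ₚ (r +ₚ r′)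
    +ₚ-assoc p r r′ = mk≋ λ i → begin
      coeff R ((p +ₚ r) +ₚ r′) i                     ≈⟨ trans (coeff-+ₚ (p +ₚ r) r′ i) (+-congʳ (coeff-+ₚ p r i)) ⟩
      (coeff R p i + coeff R r i) + coeff R r′ i     ≈⟨ +-assoc _ _ _ ⟩
      coeff R p i + (coeff R r i + coeff R r′ i)     ≈⟨ sym (trans (coeff-+ₚ p (r +ₚ r′) i) (+-congˡ (coeff-+ₚ r r′ i))) ⟩
      coeff R (p +ₚ (r +ₚ r′)) i                     ∎

    +ₚ-≋[]ʳ : ∀ p {z} → z ≋ [] → p +ₚ z ≋ p
    +ₚ-≋[]ʳ p {z} e = mk≋ λ i → trans (coeff-+ₚ p z i) (trans (+-congˡ (coeff-≈ e i)) (+-identityʳ _))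

    +ₚ-≋[]ˡ : ∀ p {z} → z ≋ [] → z +ₚ p ≋ p
    +ₚ-≋[]ˡ p {z} e = ≋-trans (+ₚ-comm z p) (+ₚ-≋[]ʳ p e)

    +ₚ-interchange : ∀ p p′ r r′ → (p +ₚ p′) +ₚ (r +ₚ r′) ≋ (p +ₚ r) +ₚ (p′ +ₚ r′)
    +ₚ-interchange p p′ r r′ = mk≋ λ i → begin
      coeff R ((p +ₚ p′) +ₚ (r +ₚ r′)) i ≈⟨ trans (coeff-+ₚ (p +ₚ p′) _ i) (+-cong (coeff-+ₚ p p′ i) (coeff-+ₚ r r′ i)) ⟩
      (coeff R p i + coeff R p′ i) + (coeff R r i + coeff R r′ i) ≈⟨ +-assoc _ _ _ ⟩
      coeff R p i + (coeff R p′ i + (coeff R r i + coeff R r′ i)) ≈⟨ +-congˡ (trans (sym (+-assoc _ _ _)) (trans (+-congʳ (+-comm _ _)) (+-assoc _ _ _))) ⟩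
      coeff R p i + (coeff R r i + (coeff R p′ i + coeff R r′ i)) ≈⟨ sym (+-assoc _ _ _) ⟩
      (coeff R p i + coeff R r i) + (coeff R p′ i + coeff R r′ i) ≈⟨ sym (trans (coeff-+ₚ (p +ₚ r) _ i) (+-cong (coeff-+ₚ p r i) (coeff-+ₚ p′ r′ i))) ⟩
      coeff R ((p +ₚ r) +ₚ (p′ +ₚ r′)) i ∎

    -ₚ-cong : ∀ {p p′ r r′} → p ≋ p′ → r ≋ r′ → p -ₚ r ≋ p′ -ₚ r′
    -ₚ-cong {p} {p′} {r} {r′} e e′ = mk≋ λ i →
      trans (coeff--ₚ p r i) (trans (+-cong (coeff-≈ e i) (-‿cong (coeff-≈ e′ i))) (sym (coeff--ₚ p′ r′ i)))

    -ₚ-inverseʳ : ∀ p → p -ₚ p ≋ []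
    -ₚ-inverseʳ p = mk≋ λ i → trans (coeff--ₚ p p i) (-‿inverseʳ _)

    -ₚ≋[]⇒≋ : ∀ p r → p -ₚ r ≋ [] → p ≋ r
    -ₚ≋[]⇒≋ p r e = mk≋ λ i → x∙y⁻¹≈ε⇒x≈y _ _ (trans (sym (coeff--ₚ p r i)) (coeff-≈ e i))

    scale-cong : ∀ {a b p p′} → a ≈ b → p ≋ p′ → scale R a p ≋ scale R b p′
    scale-cong {a} {b} {p} {p′} a≈b e = mk≋ λ i →
      trans (coeff-scale a p i) (trans (*-cong a≈b (coeff-≈ e i)) (sym (coeff-scale b p′ i)))

    scale-distribˡ : ∀ a p r → scale R a (p +ₚ r) ≋ scale R a p +ₚ scale R a r
    scale-distribˡ a p r = mk≋ λ i → begin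
      coeff R (scale R a (p +ₚ r)) i                     ≈⟨ trans (coeff-scale a (p +ₚ r) i) (*-congˡ (coeff-+ₚ p r i)) ⟩
      a * (coeff R p i + coeff R r i)                    ≈⟨ distribˡ _ _ _ ⟩
      a * coeff R p i + a * coeff R r i                  ≈⟨ sym (trans (coeff-+ₚ (scale R a p) _ i) (+-cong (coeff-scale a p i) (coeff-scale a r i))) ⟩
      coeff R (scale R a p +ₚ scale R a r) i             ∎

    scale-distribʳ : ∀ a b p → scale R (a + b) p ≋ scale R a p +ₚ scale R b p
    scale-distribʳ a b p = mk≋ λ i → begin
      coeff R (scale R (a + b) p) i                      ≈⟨ coeff-scale _ p i ⟩
      (a + b) * coeff R p i                              ≈⟨ distribʳ _ _ _ ⟩
      a * coeff R p i + b * coeff R p i                  ≈⟨ sym (trans (coeff-+ₚ (scale R a p) _ i) (+-cong (coeff-scale a p i) (coeff-scale b p i))) ⟩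
      coeff R (scale R a p +ₚ scale R b p) i             ∎

    scale-assoc : ∀ a b p → scale R a (scale R b p) ≋ scale R (a * b) p
    scale-assoc a b p = mk≋ λ i →
      trans (coeff-scale a (scale R b p) i) (trans (*-congˡ (coeff-scale b p i)) (trans (sym (*-assoc _ _ _)) (sym (coeff-scale _ p i))))

    scale-comm : ∀ a b p → scale R a (scale R b p) ≋ scale R b (scale R a p)
    scale-comm a b p = ≋-trans (scale-assoc a b p) (≋-trans (scale-cong (*-comm a b) ≋-refl) (≋-sym (scale-assoc b a p)))

    scale-zeroˡ : ∀ {a} p → a ≈ 0# → scale R a p ≋ []
    scale-zeroˡ {a} p a≈0 = mk≋ λ i → trans (coeff-scale a p i) (trans (*-congʳ a≈0) (zeroˡ _))

    scale-zeroʳ : ∀ a {p} → p ≋ [] → scale R a p ≋ []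
    scale-zeroʳ a {p} e = mk≋ λ i → trans (coeff-scale a p i) (trans (*-congˡ (coeff-≈ e i)) (zeroʳ a))

    scale-identityˡ : ∀ p → scale R 1# p ≋ p
    scale-identityˡ p = mk≋ λ i → trans (coeff-scale 1# p i) (*-identityˡ _)

    negₚ≋scale-1 : ∀ p → negₚ R p ≋ scale R (- 1#) p
    negₚ≋scale-1 p = mk≋ λ i → trans (coeff-negₚ p i) (trans (sym (-1*x≈-x _)) (sym (coeff-scale (- 1#) p i)))

  module _ where
    open ≋-Reasoning

    *ₚ-≋[]ˡ : ∀ {p} r → p ≋ [] → p *ₚ r ≋ []
    *ₚ-≋[]ˡ {[]}    r e = ≋-refl
    *ₚ-≋[]ˡ {a ∷ p} r e = ≋-trans (+ₚ-≋[]ˡ _ (scale-zeroˡ r (≋[]-head e))) (∷-≋[] refl (*ₚ-≋[]ˡ r (≋[]-tail e)))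

    *ₚ-≋[]ʳ : ∀ p {r} → r ≋ [] → p *ₚ r ≋ []
    *ₚ-≋[]ʳ []      e = ≋-refl
    *ₚ-≋[]ʳ (a ∷ p) e = ≋-trans (+ₚ-≋[]ˡ _ (scale-zeroʳ a e)) (∷-≋[] refl (*ₚ-≋[]ʳ p e))

    *ₚ-congʳ : ∀ {p p′} r → p ≋ p′ → p *ₚ r ≋ p′ *ₚ r
    *ₚ-congʳ {[]}    {p′}     r e = ≋-sym (*ₚ-≋[]ˡ r (≋-sym e))
    *ₚ-congʳ {a ∷ p} {[]}     r e = *ₚ-≋[]ˡ r e
    *ₚ-congʳ {a ∷ p} {b ∷ p′} r e =
      +ₚ-cong (scale-cong (∷-injectiveˡ e) ≋-refl) (∷-cong refl (*ₚ-congʳ r (∷-injectiveʳ e)))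

    *ₚ-congˡ : ∀ p {r r′} → r ≋ r′ → p *ₚ r ≋ p *ₚ r′
    *ₚ-congˡ []      e = ≋-refl
    *ₚ-congˡ (a ∷ p) e = +ₚ-cong (scale-cong refl e) (∷-cong refl (*ₚ-congˡ p e))

    *ₚ-cong : ∀ {p p′ r r′} → p ≋ p′ → r ≋ r′ → p *ₚ r ≋ p′ *ₚ r′
    *ₚ-cong {p′ = p′} {r} e e′ = ≋-trans (*ₚ-congʳ r e) (*ₚ-congˡ p′ e′)

    *ₚ-distribʳ : ∀ p p′ r → (p +ₚ p′) *ₚ r ≋ p *ₚ r +ₚ p′ *ₚ r
    *ₚ-distribʳ []      p′       r = ≋-refl
    *ₚ-distribʳ (a ∷ p) []       r = ≋-sym (+ₚ-≋[]ʳ _ ≋-refl)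
    *ₚ-distribʳ (a ∷ p) (b ∷ p′) r = begin
      scale R (a + b) r +ₚ (0# ∷ (p +ₚ p′) *ₚ r)
        ≈⟨ +ₚ-cong (scale-distribʳ a b r) (∷-cong (sym (+-identityˡ 0#)) (*ₚ-distribʳ p p′ r)) ⟩
      (scale R a r +ₚ scale R b r) +ₚ ((0# ∷ p *ₚ r) +ₚ (0# ∷ p′ *ₚ r))
        ≈⟨ +ₚ-interchange (scale R a r) (scale R b r) _ _ ⟩
      (scale R a r +ₚ (0# ∷ p *ₚ r)) +ₚ (scale R b r +ₚ (0# ∷ p′ *ₚ r)) ∎

    *ₚ-distribˡ : ∀ p r r′ → p *ₚ (r +ₚ r′) ≋ p *ₚ r +ₚ p *ₚ r′
    *ₚ-distribˡ []      r r′ = ≋-refl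
    *ₚ-distribˡ (a ∷ p) r r′ = begin
      scale R a (r +ₚ r′) +ₚ (0# ∷ p *ₚ (r +ₚ r′))
        ≈⟨ +ₚ-cong (scale-distribˡ a r r′) (∷-cong (sym (+-identityˡ 0#)) (*ₚ-distribˡ p r r′)) ⟩
      (scale R a r +ₚ scale R a r′) +ₚ ((0# ∷ p *ₚ r) +ₚ (0# ∷ p *ₚ r′))
        ≈⟨ +ₚ-interchange (scale R a r) (scale R a r′) _ _ ⟩
      (scale R a r +ₚ (0# ∷ p *ₚ r)) +ₚ (scale R a r′ +ₚ (0# ∷ p *ₚ r′)) ∎

    scale-*ₚˡ : ∀ a p r → scale R a p *ₚ r ≋ scale R a (p *ₚ r)
    scale-*ₚˡ a []      r = ≋-refl
    scale-*ₚˡ a (b ∷ p) r = begin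
      scale R (a * b) r +ₚ (0# ∷ scale R a p *ₚ r)
        ≈⟨ +ₚ-cong (≋-sym (scale-assoc a b r)) (∷-cong (sym (zeroʳ a)) (scale-*ₚˡ a p r)) ⟩
      scale R a (scale R b r) +ₚ scale R a (0# ∷ p *ₚ r)
        ≈⟨ ≋-sym (scale-distribˡ a (scale R b r) _) ⟩
      scale R a (scale R b r +ₚ (0# ∷ p *ₚ r)) ∎

    scale-*ₚʳ : ∀ a p r → p *ₚ scale R a r ≋ scale R a (p *ₚ r)
    scale-*ₚʳ a []      r = ≋-refl
    scale-*ₚʳ a (b ∷ p) r = begin
      scale R b (scale R a r) +ₚ (0# ∷ p *ₚ scale R a r)
        ≈⟨ +ₚ-cong (scale-comm b a r) (∷-cong (sym (zeroʳ a)) (scale-*ₚʳ a p r)) ⟩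
      scale R a (scale R b r) +ₚ scale R a (0# ∷ p *ₚ r)
        ≈⟨ ≋-sym (scale-distribˡ a (scale R b r) _) ⟩
      scale R a (scale R b r +ₚ (0# ∷ p *ₚ r)) ∎

    0∷-*ₚ : ∀ p r → (0# ∷ p) *ₚ r ≋ 0# ∷ p *ₚ r
    0∷-*ₚ p r = +ₚ-≋[]ˡ _ (scale-zeroˡ r refl)

    *ₚ-∷ : ∀ p b r → p *ₚ (b ∷ r) ≋ scale R b p +ₚ (0# ∷ p *ₚ r)
    *ₚ-∷ []      b r = ≋-sym (∷-≋[] refl ≋-refl)
    *ₚ-∷ (a ∷ p) b r = ∷-cong (trans (+-identityʳ _) (trans (*-comm a b) (sym (+-identityʳ _)))) (begin
      scale R a r +ₚ p *ₚ (b ∷ r)                      ≈⟨ +ₚ-congˡ (scale R a r) (*ₚ-∷ p b r) ⟩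
      scale R a r +ₚ (scale R b p +ₚ (0# ∷ p *ₚ r))    ≈⟨ ≋-sym (+ₚ-assoc (scale R a r) _ _) ⟩
      (scale R a r +ₚ scale R b p) +ₚ (0# ∷ p *ₚ r)    ≈⟨ +ₚ-cong (+ₚ-comm (scale R a r) (scale R b p)) ≋-refl ⟩
      (scale R b p +ₚ scale R a r) +ₚ (0# ∷ p *ₚ r)    ≈⟨ +ₚ-assoc (scale R b p) _ _ ⟩
      scale R b p +ₚ (scale R a r +ₚ (0# ∷ p *ₚ r))    ∎)

    *ₚ-comm : ∀ p r → p *ₚ r ≋ r *ₚ p
    *ₚ-comm []      r = ≋-sym (*ₚ-≋[]ʳ r ≋-refl)
    *ₚ-comm (a ∷ p) r = ≋-trans (+ₚ-congˡ (scale R a r) (∷-cong refl (*ₚ-comm p r))) (≋-sym (*ₚ-∷ r a p))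

    *ₚ-assoc : ∀ p r r′ → (p *ₚ r) *ₚ r′ ≋ p *ₚ (r *ₚ r′)
    *ₚ-assoc []      r r′ = ≋-refl
    *ₚ-assoc (a ∷ p) r r′ = begin
      (scale R a r +ₚ (0# ∷ p *ₚ r)) *ₚ r′              ≈⟨ *ₚ-distribʳ (scale R a r) _ r′ ⟩
      scale R a r *ₚ r′ +ₚ (0# ∷ p *ₚ r) *ₚ r′          ≈⟨ +ₚ-cong (scale-*ₚˡ a r r′) (≋-trans (0∷-*ₚ (p *ₚ r) r′) (∷-cong refl (*ₚ-assoc p r r′))) ⟩
      scale R a (r *ₚ r′) +ₚ (0# ∷ p *ₚ (r *ₚ r′))      ∎

    *ₚ-identityˡ : ∀ p → oneₚ R *ₚ p ≋ p
    *ₚ-identityˡ p = ≋-trans (+ₚ-≋[]ʳ (scale R 1# p) (∷-≋[] refl ≋-refl)) (scale-identityˡ p)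

    *ₚ-identityʳ : ∀ p → p *ₚ oneₚ R ≋ p
    *ₚ-identityʳ p = ≋-trans (*ₚ-comm p (oneₚ R)) (*ₚ-identityˡ p)

    const-*ₚ : ∀ a p → const R a *ₚ p ≋ scale R a p
    const-*ₚ a p = +ₚ-≋[]ʳ (scale R a p) (∷-≋[] refl ≋-refl)

    *ₚ-negₚʳ : ∀ p r → p *ₚ negₚ R r ≋ negₚ R (p *ₚ r)
    *ₚ-negₚʳ p r = begin
      p *ₚ negₚ R r           ≈⟨ *ₚ-congˡ p (negₚ≋scale-1 r) ⟩
      p *ₚ scale R (- 1#) r   ≈⟨ scale-*ₚʳ (- 1#) p r ⟩
      scale R (- 1#) (p *ₚ r) ≈⟨ ≋-sym (negₚ≋scale-1 (p *ₚ r)) ⟩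
      negₚ R (p *ₚ r)         ∎

    *ₚ-distribˡ--ₚ : ∀ p r r′ → p *ₚ (r -ₚ r′) ≋ p *ₚ r -ₚ p *ₚ r′
    *ₚ-distribˡ--ₚ p r r′ = ≋-trans (*ₚ-distribˡ p r (negₚ R r′)) (+ₚ-congˡ (p *ₚ r) (*ₚ-negₚʳ p r′))

  module _ where
    open SetoidReasoning setoid

    eval-≋[] : ∀ {p} y → p ≋ [] → eval R p y ≈ 0#
    eval-≋[] {[]}    y e = refl
    eval-≋[] {a ∷ p} y e = trans (+-cong (≋[]-head e) (trans (*-congˡ (eval-≋[] y (≋[]-tail e))) (zeroʳ y))) (+-identityʳ 0#)

    eval-cong : ∀ {p p′} y → p ≋ p′ → eval R p y ≈ eval R p′ y
    eval-cong {[]}    {p′}     y e = sym (eval-≋[] y (≋-sym e))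
    eval-cong {a ∷ p} {[]}     y e = eval-≋[] y e
    eval-cong {a ∷ p} {b ∷ p′} y e = +-cong (∷-injectiveˡ e) (*-congˡ (eval-cong y (∷-injectiveʳ e)))

    eval-congʳ : ∀ p {y y′} → y ≈ y′ → eval R p y ≈ eval R p y′
    eval-congʳ []      e = refl
    eval-congʳ (b ∷ p) e = +-congˡ (*-cong e (eval-congʳ p e))

    eval-+ₚ : ∀ p r y → eval R (p +ₚ r) y ≈ eval R p y + eval R r y
    eval-+ₚ []      r       y = sym (+-identityˡ _)
    eval-+ₚ (a ∷ p) []      y = sym (+-identityʳ _)
    eval-+ₚ (a ∷ p) (b ∷ r) y = begin
      (a + b) + y * eval R (p +ₚ r) y                ≈⟨ +-congˡ (trans (*-congˡ (eval-+ₚ p r y)) (distribˡ _ _ _)) ⟩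
      (a + b) + (y * eval R p y + y * eval R r y)    ≈⟨ +-assoc _ _ _ ⟩
      a + (b + (y * eval R p y + y * eval R r y))    ≈⟨ +-congˡ (trans (sym (+-assoc _ _ _)) (trans (+-congʳ (+-comm _ _)) (+-assoc _ _ _))) ⟩
      a + (y * eval R p y + (b + y * eval R r y))    ≈⟨ sym (+-assoc _ _ _) ⟩
      (a + y * eval R p y) + (b + y * eval R r y)    ∎

    eval-scale : ∀ a p y → eval R (scale R a p) y ≈ a * eval R p y
    eval-scale a []      y = sym (zeroʳ a)
    eval-scale a (b ∷ p) y = begin
      a * b + y * eval R (scale R a p) y   ≈⟨ +-congˡ (*-congˡ (eval-scale a p y)) ⟩
      a * b + y * (a * eval R p y)         ≈⟨ +-congˡ (trans (sym (*-assoc _ _ _)) (trans (*-congʳ (*-comm y a)) (*-assoc _ _ _))) ⟩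
      a * b + a * (y * eval R p y)         ≈⟨ sym (distribˡ _ _ _) ⟩
      a * (b + y * eval R p y)             ∎

    eval-*ₚ : ∀ p r y → eval R (p *ₚ r) y ≈ eval R p y * eval R r y
    eval-*ₚ []      r y = sym (zeroˡ _)
    eval-*ₚ (a ∷ p) r y = begin
      eval R (scale R a r +ₚ (0# ∷ p *ₚ r)) y           ≈⟨ eval-+ₚ (scale R a r) _ y ⟩
      eval R (scale R a r) y + (0# + y * eval R (p *ₚ r) y) ≈⟨ +-cong (eval-scale a r y) (trans (+-identityˡ _) (*-congˡ (eval-*ₚ p r y))) ⟩
      a * eval R r y + y * (eval R p y * eval R r y)    ≈⟨ +-congˡ (sym (*-assoc _ _ _)) ⟩
      a * eval R r y + (y * eval R p y) * eval R r y    ≈⟨ sym (distribʳ _ _ _) ⟩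
      (a + y * eval R p y) * eval R r y                 ∎

    eval-negₚ : ∀ p y → eval R (negₚ R p) y ≈ - eval R p y
    eval-negₚ []      y = sym -0#≈0#
    eval-negₚ (a ∷ p) y = begin
      - a + y * eval R (negₚ R p) y   ≈⟨ +-congˡ (trans (*-congˡ (eval-negₚ p y)) (sym (-‿distribʳ-* y _))) ⟩
      - a + - (y * eval R p y)        ≈⟨ ⁻¹-∙-comm a _ ⟩
      - (a + y * eval R p y)          ∎

    eval--ₚ : ∀ p r y → eval R (p -ₚ r) y ≈ eval R p y - eval R r y
    eval--ₚ p r y = trans (eval-+ₚ p (negₚ R r) y) (+-congˡ (eval-negₚ r y))

    eval-const : ∀ a y → eval R (const R a) y ≈ a
    eval-const a y = trans (+-congˡ (zeroʳ y)) (+-identityʳ a)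

    eval-xpow : ∀ t y → eval R (xpow R t) y ≈ D._^'_ R y t
    eval-xpow zero    y = eval-const 1# y
    eval-xpow (suc t) y = trans (+-identityˡ _) (*-congˡ (eval-xpow t y))

    root-of-xᵉ-1 : ∀ {f h y} e → xpow R e -ₚ oneₚ R ≋ f *ₚ h → eval R f y ≈ 0# → D._^'_ R y e ≈ 1#
    root-of-xᵉ-1 {f} {h} {y} e xᵉ-1≋fh f[y]≈0 = x∙y⁻¹≈ε⇒x≈y _ _ (begin
      D._^'_ R y e - 1#                              ≈⟨ +-cong (eval-xpow e y) (-‿cong (eval-const 1# y)) ⟨
      eval R (xpow R e) y - eval R (oneₚ R) y        ≈⟨ eval--ₚ (xpow R e) (oneₚ R) y ⟨
      eval R (xpow R e -ₚ oneₚ R) y                  ≈⟨ eval-cong y xᵉ-1≋fh ⟩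
      eval R (f *ₚ h) y                              ≈⟨ eval-*ₚ f h y ⟩
      eval R f y * eval R h y                        ≈⟨ *-congʳ f[y]≈0 ⟩
      0# * eval R h y                                ≈⟨ zeroˡ _ ⟩
      0#                                             ∎)

  prodₚ-suc : ∀ k F → prodₚ R (suc k) F ≡ F 0 *ₚ prodₚ R k (F ∘ suc)
  prodₚ-suc k F = ≡.cong (F 0 *ₚ_) (shift k F suc)
    where
      shift : ∀ k F (f : ℕ → ℕ) → foldr (λ i acc → F i *ₚ acc) (oneₚ R) (applyUpTo f k) ≡ prodₚ R k (F ∘ f)
      shift zero    F f = ≡.refl
      shift (suc k) F f = ≡.cong (F (f 0) *ₚ_) (≡.trans (shift k F (f ∘ suc)) (≡.sym (shift k (F ∘ f) suc)))

  module _ where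
    open ≋-Reasoning

    prodₚ-cong : ∀ k {F G : ℕ → Poly R} → (∀ i → i ℕ.< k → F i ≋ G i) → prodₚ R k F ≋ prodₚ R k G
    prodₚ-cong zero    F≋G = ≋-refl
    prodₚ-cong (suc k) {F} {G} F≋G = begin
      prodₚ R (suc k) F            ≡⟨ prodₚ-suc k F ⟩
      F 0 *ₚ prodₚ R k (F ∘ suc)   ≈⟨ *ₚ-cong (F≋G 0 (ℕ.s≤s ℕ.z≤n)) (prodₚ-cong k λ i i<k → F≋G (suc i) (ℕ.s≤s i<k)) ⟩
      G 0 *ₚ prodₚ R k (G ∘ suc)   ≡⟨ prodₚ-suc k G ⟨
      prodₚ R (suc k) G            ∎

    prodₚ-sucʳ : ∀ k F → prodₚ R (suc k) F ≋ prodₚ R k F *ₚ F k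
    prodₚ-sucʳ zero    F = ≋-trans (*ₚ-identityʳ (F 0)) (≋-sym (*ₚ-identityˡ (F 0)))
    prodₚ-sucʳ (suc k) F = begin
      prodₚ R (suc (suc k)) F                      ≡⟨ prodₚ-suc (suc k) F ⟩
      F 0 *ₚ prodₚ R (suc k) (F ∘ suc)             ≈⟨ *ₚ-congˡ (F 0) (prodₚ-sucʳ k (F ∘ suc)) ⟩
      F 0 *ₚ (prodₚ R k (F ∘ suc) *ₚ F (suc k))    ≈⟨ *ₚ-assoc (F 0) _ _ ⟨
      (F 0 *ₚ prodₚ R k (F ∘ suc)) *ₚ F (suc k)    ≡⟨ ≡.cong (_*ₚ F (suc k)) (prodₚ-suc k F) ⟨
      prodₚ R (suc k) F *ₚ F (suc k)               ∎

    prodₚ-rotate : ∀ k F → F k ≋ F 0 → prodₚ R k (F ∘ suc) ≋ prodₚ R k F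
    prodₚ-rotate zero    F e = ≋-refl
    prodₚ-rotate (suc k) F e = begin
      prodₚ R (suc k) (F ∘ suc)              ≈⟨ prodₚ-sucʳ k (F ∘ suc) ⟩
      prodₚ R k (F ∘ suc) *ₚ F (suc k)       ≈⟨ *ₚ-congˡ (prodₚ R k (F ∘ suc)) e ⟩
      prodₚ R k (F ∘ suc) *ₚ F 0             ≈⟨ *ₚ-comm _ (F 0) ⟩
      F 0 *ₚ prodₚ R k (F ∘ suc)             ≡⟨ prodₚ-suc k F ⟨
      prodₚ R (suc k) F                      ∎

    prodₚ-periodic-shift : ∀ k F → (∀ i → F (i ℕ.+ k) ≋ F i) → ∀ c → prodₚ R k (λ i → F (i ℕ.+ c)) ≋ prodₚ R k F
    prodₚ-periodic-shift k F periodic zero    = prodₚ-cong k λ i _ → ≋-reflexive (≡.cong F (ℕP.+-identityʳ i))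
    prodₚ-periodic-shift k F periodic (suc c) = begin
      prodₚ R k (λ i → F (i ℕ.+ suc c))      ≈⟨ prodₚ-cong k (λ i _ → ≋-reflexive (≡.cong F (ℕP.+-suc i c))) ⟩
      prodₚ R k (λ i → F (suc i ℕ.+ c))      ≈⟨ prodₚ-rotate k (λ i → F (i ℕ.+ c)) (≋-trans (≋-reflexive (≡.cong F (ℕP.+-comm k c))) (periodic c)) ⟩
      prodₚ R k (λ i → F (i ℕ.+ c))          ≈⟨ prodₚ-periodic-shift k F periodic c ⟩
      prodₚ R k F                            ∎

  module Map {φ : Carrier → Carrier} (φ-hom : IsRingHomomorphism φ) where
    open IsRingHomomorphism φ-hom
    module _ where
      open SetoidReasoning setoid

      coeff-map : ∀ p i → coeff R (map φ p) i ≈ φ (coeff R p i)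
      coeff-map []      i       = sym 0#-homo
      coeff-map (a ∷ p) zero    = refl
      coeff-map (a ∷ p) (suc i) = coeff-map p i

      map-cong : ∀ {p p′} → p ≋ p′ → map φ p ≋ map φ p′
      map-cong {p} {p′} e = mk≋ λ i → trans (coeff-map p i) (trans (⟦⟧-cong (coeff-≈ e i)) (sym (coeff-map p′ i)))

      map-+ₚ : ∀ p r → map φ (p +ₚ r) ≋ map φ p +ₚ map φ r
      map-+ₚ p r = mk≋ λ i → begin
        coeff R (map φ (p +ₚ r)) i               ≈⟨ trans (coeff-map (p +ₚ r) i) (⟦⟧-cong (coeff-+ₚ p r i)) ⟩
        φ (coeff R p i + coeff R r i)            ≈⟨ +-homo _ _ ⟩
        φ (coeff R p i) + φ (coeff R r i)        ≈⟨ sym (trans (coeff-+ₚ (map φ p) (map φ r) i) (+-cong (coeff-map p i) (coeff-map r i))) ⟩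
        coeff R (map φ p +ₚ map φ r) i           ∎

      map-scale : ∀ a p → map φ (scale R a p) ≋ scale R (φ a) (map φ p)
      map-scale a p = mk≋ λ i → begin
        coeff R (map φ (scale R a p)) i          ≈⟨ trans (coeff-map (scale R a p) i) (⟦⟧-cong (coeff-scale a p i)) ⟩
        φ (a * coeff R p i)                      ≈⟨ *-homo _ _ ⟩
        φ a * φ (coeff R p i)                    ≈⟨ sym (trans (coeff-scale (φ a) (map φ p) i) (*-congˡ (coeff-map p i))) ⟩
        coeff R (scale R (φ a) (map φ p)) i      ∎

      map-negₚ : ∀ p → map φ (negₚ R p) ≋ negₚ R (map φ p)
      map-negₚ p = mk≋ λ i → begin
        coeff R (map φ (negₚ R p)) i             ≈⟨ trans (coeff-map (negₚ R p) i) (⟦⟧-cong (coeff-negₚ p i)) ⟩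
        φ (- coeff R p i)                        ≈⟨ -‿homo _ ⟩
        - φ (coeff R p i)                        ≈⟨ sym (trans (coeff-negₚ (map φ p) i) (-‿cong (coeff-map p i))) ⟩
        coeff R (negₚ R (map φ p)) i             ∎

      map--ₚ : ∀ p r → map φ (p -ₚ r) ≋ map φ p -ₚ map φ r
      map--ₚ p r = ≋-trans (map-+ₚ p (negₚ R r)) (+ₚ-congˡ (map φ p) (map-negₚ r))

      map-*ₚ : ∀ p r → map φ (p *ₚ r) ≋ map φ p *ₚ map φ r
      map-*ₚ []      r = ≋-refl
      map-*ₚ (a ∷ p) r = ≋-trans (map-+ₚ (scale R a r) (0# ∷ p *ₚ r)) (+ₚ-cong (map-scale a r) (∷-cong 0#-homo (map-*ₚ p r)))

      map-xpow : ∀ t → map φ (xpow R t) ≋ xpow R t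
      map-xpow zero    = ∷-cong 1#-homo ≋-refl
      map-xpow (suc t) = ∷-cong 0#-homo (map-xpow t)

      eval-map : ∀ p y → eval R (map φ p) (φ y) ≈ φ (eval R p y)
      eval-map []      y = sym 0#-homo
      eval-map (a ∷ p) y = begin
        φ a + φ y * eval R (map φ p) (φ y)   ≈⟨ +-congˡ (*-congˡ (eval-map p y)) ⟩
        φ a + φ y * φ (eval R p y)           ≈⟨ sym (trans (+-homo _ _) (+-congˡ (*-homo _ _))) ⟩
        φ (a + y * eval R p y)               ∎

    map-prodₚ : ∀ k F → map φ (prodₚ R k F) ≋ prodₚ R k (map φ ∘ F)
    map-prodₚ zero    F = ∷-cong 1#-homo ≋-refl
    map-prodₚ (suc k) F = begin
      map φ (prodₚ R (suc k) F)                       ≡⟨ ≡.cong (map φ) (prodₚ-suc k F) ⟩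
      map φ (F 0 *ₚ prodₚ R k (F ∘ suc))              ≈⟨ map-*ₚ (F 0) _ ⟩
      map φ (F 0) *ₚ map φ (prodₚ R k (F ∘ suc))      ≈⟨ *ₚ-congˡ (map φ (F 0)) (map-prodₚ k (F ∘ suc)) ⟩
      map φ (F 0) *ₚ prodₚ R k (map φ ∘ F ∘ suc)      ≡⟨ prodₚ-suc k (map φ ∘ F) ⟨
      prodₚ R (suc k) (map φ ∘ F)                     ∎
      where open ≋-Reasoning

  module Stretch (t : ℕ) .{{_ : NonZero t}} where

    shiftₚ : ℕ → Poly R → Poly R
    shiftₚ n p = replicate n 0# ++ p

    -- p ↦ p (x ^ t)
    stretch : Poly R → Poly R
    stretch []      = []
    stretch (a ∷ p) = a ∷ shiftₚ (ℕ.pred t) (stretch p)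

    shiftₚ-cong : ∀ n {p p′} → p ≋ p′ → shiftₚ n p ≋ shiftₚ n p′
    shiftₚ-cong zero    e = e
    shiftₚ-cong (suc n) e = ∷-cong refl (shiftₚ-cong n e)

    shiftₚ-≋[] : ∀ n {p} → p ≋ [] → shiftₚ n p ≋ []
    shiftₚ-≋[] zero    e = e
    shiftₚ-≋[] (suc n) e = ∷-≋[] refl (shiftₚ-≋[] n e)

    shiftₚ-+ₚ : ∀ n p r → shiftₚ n (p +ₚ r) ≋ shiftₚ n p +ₚ shiftₚ n r
    shiftₚ-+ₚ zero    p r = ≋-refl
    shiftₚ-+ₚ (suc n) p r = ∷-cong (sym (+-identityˡ 0#)) (shiftₚ-+ₚ n p r)

    shiftₚ-scale : ∀ n a p → scale R a (shiftₚ n p) ≋ shiftₚ n (scale R a p)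
    shiftₚ-scale zero    a p = ≋-refl
    shiftₚ-scale (suc n) a p = ∷-cong (zeroʳ a) (shiftₚ-scale n a p)

    shiftₚ-*ₚ : ∀ n p r → shiftₚ n p *ₚ r ≋ shiftₚ n (p *ₚ r)
    shiftₚ-*ₚ zero    p r = ≋-refl
    shiftₚ-*ₚ (suc n) p r = ≋-trans (0∷-*ₚ (shiftₚ n p) r) (∷-cong refl (shiftₚ-*ₚ n p r))

    coeff-shiftₚ : ∀ n p i → coeff R (shiftₚ n p) (n ℕ.+ i) ≡ coeff R p i
    coeff-shiftₚ zero    p i = ≡.refl
    coeff-shiftₚ (suc n) p i = coeff-shiftₚ n p i

    stretch-≋[] : ∀ {p} → p ≋ [] → stretch p ≋ []
    stretch-≋[] {[]}    e = ≋-refl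
    stretch-≋[] {a ∷ p} e = ∷-≋[] (≋[]-head e) (shiftₚ-≋[] _ (stretch-≋[] (≋[]-tail e)))

    stretch-cong : ∀ {p p′} → p ≋ p′ → stretch p ≋ stretch p′
    stretch-cong {[]}    {p′}     e = ≋-sym (stretch-≋[] (≋-sym e))
    stretch-cong {a ∷ p} {[]}     e = stretch-≋[] e
    stretch-cong {a ∷ p} {b ∷ p′} e = ∷-cong (∷-injectiveˡ e) (shiftₚ-cong _ (stretch-cong (∷-injectiveʳ e)))

    stretch-+ₚ : ∀ p r → stretch (p +ₚ r) ≋ stretch p +ₚ stretch r
    stretch-+ₚ []      r       = ≋-refl
    stretch-+ₚ (a ∷ p) []      = ≋-refl
    stretch-+ₚ (a ∷ p) (b ∷ r) = ∷-cong refl (≋-trans (shiftₚ-cong _ (stretch-+ₚ p r)) (shiftₚ-+ₚ _ (stretch p) (stretch r)))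

    stretch-scale : ∀ a p → stretch (scale R a p) ≋ scale R a (stretch p)
    stretch-scale a []      = ≋-refl
    stretch-scale a (b ∷ p) = ∷-cong refl (≋-trans (shiftₚ-cong _ (stretch-scale a p)) (≋-sym (shiftₚ-scale _ a (stretch p))))

    stretch-*ₚ : ∀ p r → stretch (p *ₚ r) ≋ stretch p *ₚ stretch r
    stretch-*ₚ []      r = ≋-refl
    stretch-*ₚ (a ∷ p) r = ≋-trans (stretch-+ₚ (scale R a r) (0# ∷ p *ₚ r))
      (+ₚ-cong (stretch-scale a r) (∷-cong refl (≋-trans (shiftₚ-cong _ (stretch-*ₚ p r)) (≋-sym (shiftₚ-*ₚ _ (stretch p) (stretch r))))))

    stretch--ₚ : ∀ p r → stretch (p -ₚ r) ≋ stretch p -ₚ stretch r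
    stretch--ₚ p r = ≋-trans (stretch-+ₚ p (negₚ R r)) (+ₚ-congˡ (stretch p) (begin
      stretch (negₚ R r)            ≈⟨ stretch-cong (negₚ≋scale-1 r) ⟩
      stretch (scale R (- 1#) r)    ≈⟨ stretch-scale (- 1#) r ⟩
      scale R (- 1#) (stretch r)    ≈⟨ ≋-sym (negₚ≋scale-1 (stretch r)) ⟩
      negₚ R (stretch r)            ∎))
      where open ≋-Reasoning

    stretch-const : ∀ b → stretch (const R b) ≋ const R b
    stretch-const b = ∷-cong refl (shiftₚ-≋[] _ ≋-refl)

    stretch-x : stretch (xpow R 1) ≋ xpow R t
    stretch-x = ≋-trans (∷-cong refl (shiftₚ-cong _ (∷-cong refl (shiftₚ-≋[] _ ≋-refl))))
                        (≋-reflexive (≡.cong (xpow R) (ℕP.suc-pred t)))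

    stretch-prodₚ : ∀ k F → stretch (prodₚ R k F) ≋ prodₚ R k (stretch ∘ F)
    stretch-prodₚ zero    F = stretch-const 1#
    stretch-prodₚ (suc k) F = begin
      stretch (prodₚ R (suc k) F)                   ≡⟨ ≡.cong stretch (prodₚ-suc k F) ⟩
      stretch (F 0 *ₚ prodₚ R k (F ∘ suc))          ≈⟨ stretch-*ₚ (F 0) _ ⟩
      stretch (F 0) *ₚ stretch (prodₚ R k (F ∘ suc)) ≈⟨ *ₚ-congˡ (stretch (F 0)) (stretch-prodₚ k (F ∘ suc)) ⟩
      stretch (F 0) *ₚ prodₚ R k (stretch ∘ F ∘ suc) ≡⟨ prodₚ-suc k (stretch ∘ F) ⟨
      prodₚ R (suc k) (stretch ∘ F)                 ∎
      where open ≋-Reasoning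

    coeff-stretch : ∀ p j → coeff R (stretch p) (t ℕ.* j) ≈ coeff R p j
    coeff-stretch []      j       = refl
    coeff-stretch (a ∷ p) zero    = reflexive (≡.cong (coeff R (a ∷ _)) (ℕP.*-zeroʳ t))
    coeff-stretch (a ∷ p) (suc j) = begin
      coeff R (stretch (a ∷ p)) (t ℕ.* suc j)                               ≡⟨ ≡.cong (coeff R (stretch (a ∷ p))) t*[1+j]≡ ⟩
      coeff R (shiftₚ (ℕ.pred t) (stretch p)) (ℕ.pred t ℕ.+ t ℕ.* j)        ≡⟨ coeff-shiftₚ (ℕ.pred t) (stretch p) _ ⟩
      coeff R (stretch p) (t ℕ.* j)                                          ≈⟨ coeff-stretch p j ⟩
      coeff R p j                                                            ∎
      where
        open SetoidReasoning setoid
        t*[1+j]≡ : t ℕ.* suc j ≡ suc (ℕ.pred t ℕ.+ t ℕ.* j)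
        t*[1+j]≡ = ≡.trans (ℕP.*-suc t j) (≡.cong (ℕ._+ t ℕ.* j) (≡.sym (ℕP.suc-pred t)))

  linear : Carrier → Poly R
  linear r = - r ∷ 1# ∷ []

  linear≋ : ∀ r → xpow R 1 -ₚ const R r ≋ linear r
  linear≋ r = ∷-cong (+-identityˡ _) ≋-refl

  linear-cong : ∀ {r r′} → r ≈ r′ → linear r ≋ linear r′
  linear-cong e = ∷-cong (-‿cong e) ≋-refl

  module _ where
    open SetoidReasoning setoid

    eval-linear : ∀ r y → eval R (linear r) y ≈ y - r
    eval-linear r y = begin
      - r + y * (1# + y * 0#)   ≈⟨ +-congˡ (*-congˡ (trans (+-congˡ (zeroʳ y)) (+-identityʳ 1#))) ⟩
      - r + y * 1#              ≈⟨ +-congˡ (*-identityʳ y) ⟩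
      - r + y                   ≈⟨ +-comm _ _ ⟩
      y - r                     ∎

    coeff-linear-*ₚ-0 : ∀ r p → coeff R (linear r *ₚ p) 0 ≈ - r * coeff R p 0
    coeff-linear-*ₚ-0 r p = trans (coeff-+ₚ (scale R (- r) p) _ 0) (trans (+-identityʳ _) (coeff-scale (- r) p 0))

    coeff-linear-*ₚ-suc : ∀ r p i → coeff R (linear r *ₚ p) (suc i) ≈ - r * coeff R p (suc i) + coeff R p i
    coeff-linear-*ₚ-suc r p i = trans (coeff-+ₚ (scale R (- r) p) _ (suc i))
      (+-cong (coeff-scale (- r) p (suc i)) (coeff-≈ (*ₚ-identityˡ p) i))

    map-linear : ∀ {φ} (φ-hom : IsRingHomomorphism φ) r → map φ (linear r) ≋ linear (φ r)
    map-linear φ-hom r = ∷-cong (-‿homo r) (∷-cong 1#-homo ≋-refl)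
      where open IsRingHomomorphism φ-hom

    -- synthetic division by x - r
    quotient : Carrier → Poly R → Poly R
    quotient r []      = []
    quotient r (a ∷ p) = eval R p r ∷ quotient r p

    division : ∀ r p → p ≋ linear r *ₚ quotient r p +ₚ const R (eval R p r)
    division r p = mk≋ (coeff-division p)
      where
        coeff-division : ∀ p i → coeff R p i ≈ coeff R (linear r *ₚ quotient r p +ₚ const R (eval R p r)) i
        coeff-division []      i       = sym (trans (coeff-+ₚ (linear r *ₚ []) (const R 0#) i)
                                           (trans (+-cong (coeff-≈ (*ₚ-≋[]ʳ (linear r) ≋-refl) i) (coeff-≈ (∷-≋[] refl ≋-refl) i)) (+-identityʳ 0#)))
        coeff-division (a ∷ p) zero    = sym (begin
          coeff R (linear r *ₚ quotient r (a ∷ p)) 0 + (a + r * eval R p r) ≈⟨ +-congʳ (coeff-linear-*ₚ-0 r (quotient r (a ∷ p))) ⟩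
          - r * eval R p r + (a + r * eval R p r)                           ≈⟨ +-congˡ (+-comm _ _) ⟩
          - r * eval R p r + (r * eval R p r + a)                           ≈⟨ sym (+-assoc _ _ _) ⟩
          (- r * eval R p r + r * eval R p r) + a                           ≈⟨ +-congʳ (trans (sym (distribʳ _ _ _)) (trans (*-congʳ (-‿inverseˡ r)) (zeroˡ _))) ⟩
          0# + a                                                            ≈⟨ +-identityˡ a ⟩
          a                                                                 ∎)
        coeff-division (a ∷ p) (suc i) = begin
          coeff R p i                                                                 ≈⟨ coeff-division p i ⟩
          coeff R (linear r *ₚ quotient r p +ₚ const R (eval R p r)) i                ≈⟨ coeff-+ₚ (linear r *ₚ quotient r p) _ i ⟩
          coeff R (linear r *ₚ quotient r p) i + coeff R (const R (eval R p r)) i     ≈⟨ shifted i ⟩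
          - r * coeff R (quotient r p) i + coeff R (eval R p r ∷ quotient r p) i      ≈⟨ coeff-linear-*ₚ-suc r (quotient r (a ∷ p)) i ⟨
          coeff R (linear r *ₚ quotient r (a ∷ p)) (suc i)                            ≈⟨ +-identityʳ _ ⟨
          coeff R (linear r *ₚ quotient r (a ∷ p)) (suc i) + 0#                       ≈⟨ coeff-+ₚ (linear r *ₚ quotient r (a ∷ p)) (const R (eval R (a ∷ p) r)) (suc i) ⟨
          coeff R (linear r *ₚ quotient r (a ∷ p) +ₚ const R (eval R (a ∷ p) r)) (suc i) ∎
          where
            shifted : ∀ i → coeff R (linear r *ₚ quotient r p) i + coeff R (const R (eval R p r)) i
                          ≈ - r * coeff R (quotient r p) i + coeff R (eval R p r ∷ quotient r p) i
            shifted zero    = +-congʳ (coeff-linear-*ₚ-0 r (quotient r p))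
            shifted (suc i) = trans (+-identityʳ _) (coeff-linear-*ₚ-suc r (quotient r p) i)

    factor-theorem : ∀ r p → eval R p r ≈ 0# → p ≋ linear r *ₚ quotient r p
    factor-theorem r p root = ≋-trans (division r p) (+ₚ-≋[]ʳ _ (∷-≋[] root ≋-refl))

    prodₚ-linear-top : ∀ (ρ : ℕ → Carrier) m → coeff R (prodₚ R m (linear ∘ ρ)) m ≈ 1#
    prodₚ-linear-above : ∀ (ρ : ℕ → Carrier) m i → m ℕ.< i → coeff R (prodₚ R m (linear ∘ ρ)) i ≈ 0#
    prodₚ-linear-top ρ zero    = refl
    prodₚ-linear-top ρ (suc m) = begin
      coeff R (prodₚ R (suc m) (linear ∘ ρ)) (suc m)                     ≡⟨ ≡.cong (λ p → coeff R p (suc m)) (prodₚ-suc m (linear ∘ ρ)) ⟩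
      coeff R (linear (ρ 0) *ₚ Π) (suc m)                                ≈⟨ coeff-linear-*ₚ-suc (ρ 0) Π m ⟩
      - ρ 0 * coeff R Π (suc m) + coeff R Π m
        ≈⟨ +-cong (trans (*-congˡ (prodₚ-linear-above (ρ ∘ suc) m (suc m) (ℕP.n<1+n m))) (zeroʳ _)) (prodₚ-linear-top (ρ ∘ suc) m) ⟩
      0# + 1#                                                            ≈⟨ +-identityˡ 1# ⟩
      1#                                                                 ∎
      where Π = prodₚ R m (linear ∘ ρ ∘ suc)
    prodₚ-linear-above ρ zero    (suc i) _           = refl
    prodₚ-linear-above ρ (suc m) (suc i) (ℕ.s≤s m<i) = begin
      coeff R (prodₚ R (suc m) (linear ∘ ρ)) (suc i)                     ≡⟨ ≡.cong (λ p → coeff R p (suc i)) (prodₚ-suc m (linear ∘ ρ)) ⟩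
      coeff R (linear (ρ 0) *ₚ Π) (suc i)                                ≈⟨ coeff-linear-*ₚ-suc (ρ 0) Π i ⟩
      - ρ 0 * coeff R Π (suc i) + coeff R Π i
        ≈⟨ +-cong (trans (*-congˡ (prodₚ-linear-above (ρ ∘ suc) m (suc i) (ℕP.m<n⇒m<1+n m<i))) (zeroʳ _)) (prodₚ-linear-above (ρ ∘ suc) m i m<i) ⟩
      0# + 0#                                                            ≈⟨ +-identityˡ 0# ⟩
      0#                                                                 ∎
      where Π = prodₚ R m (linear ∘ ρ ∘ suc)

  module IntegralDomain (0≉1 : ¬ 0# ≈ 1#) (zero-product : ∀ {x y} → x * y ≈ 0# → x ≈ 0# ⊎ y ≈ 0#) where
    open SetoidReasoning setoid

    linear-*ₚ-cancel : ∀ {r} p → ¬ r ≈ 0# → linear r *ₚ p ≋ [] → p ≋ []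
    linear-*ₚ-cancel {r} p r≉0 e = mk≋ coeff≈0
      where
        -r≉0 : ¬ - r ≈ 0#
        -r≉0 -r≈0 = r≉0 (trans (sym (⁻¹-involutive r)) (trans (-‿cong -r≈0) -0#≈0#))
        coeff≈0 : ∀ i → coeff R p i ≈ 0#
        coeff≈0 zero with zero-product (trans (sym (coeff-linear-*ₚ-0 r p)) (coeff-≈ e 0))
        ... | inj₁ -r≈0 = contradiction -r≈0 -r≉0
        ... | inj₂ p₀≈0 = p₀≈0
        coeff≈0 (suc i) with zero-product { - r} {coeff R p (suc i)} (begin
          - r * coeff R p (suc i)                  ≈⟨ +-identityʳ _ ⟨
          - r * coeff R p (suc i) + 0#             ≈⟨ +-congˡ (coeff≈0 i) ⟨
          - r * coeff R p (suc i) + coeff R p i    ≈⟨ coeff-linear-*ₚ-suc r p i ⟨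
          coeff R (linear r *ₚ p) (suc i)          ≈⟨ coeff-≈ e (suc i) ⟩
          0#                                       ∎)
        ... | inj₁ -r≈0   = contradiction -r≈0 -r≉0
        ... | inj₂ pᵢ₊₁≈0 = pᵢ₊₁≈0

    prodₚ-linear-*ₚ-cancel : ∀ {ρ : ℕ → Carrier} → (∀ i → ¬ ρ i ≈ 0#) → ∀ m p → prodₚ R m (linear ∘ ρ) *ₚ p ≋ [] → p ≋ []
    prodₚ-linear-*ₚ-cancel ρ≉0 zero    p e = ≋-trans (≋-sym (*ₚ-identityˡ p)) e
    prodₚ-linear-*ₚ-cancel {ρ} ρ≉0 (suc m) p e =
      prodₚ-linear-*ₚ-cancel (ρ≉0 ∘ suc) m p (linear-*ₚ-cancel (prodₚ R m (linear ∘ ρ ∘ suc) *ₚ p) (ρ≉0 0)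
        (≋-trans (≋-sym (*ₚ-assoc (linear (ρ 0)) (prodₚ R m (linear ∘ ρ ∘ suc)) p)) (≋-trans (*ₚ-congʳ p (≋-reflexive (≡.sym (prodₚ-suc m (linear ∘ ρ))))) e)))

    eval-prodₚ≈0 : ∀ k F y → eval R (prodₚ R k F) y ≈ 0# → ∃ λ i → i ℕ.< k × eval R (F i) y ≈ 0#
    eval-prodₚ≈0 zero    F y e = contradiction (trans (sym e) (eval-const 1# y)) 0≉1
    eval-prodₚ≈0 (suc k) F y e
      with zero-product (trans (sym (eval-*ₚ (F 0) (prodₚ R k (F ∘ suc)) y)) (trans (reflexive (≡.cong (λ p → eval R p y) (≡.sym (prodₚ-suc k F)))) e))
    ... | inj₁ F₀y≈0 = 0 , ℕ.s≤s ℕ.z≤n , F₀y≈0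
    ... | inj₂ rest≈0 with eval-prodₚ≈0 k (F ∘ suc) y rest≈0
    ...   | i , i<k , Fᵢy≈0 = suc i , ℕ.s≤s i<k , Fᵢy≈0

module Powers {c ℓ} (R : CommutativeRing c ℓ) where
  open CommutativeRing R hiding (zero)
  open import Algebra.Properties.Semiring.Exp semiring using (_^_; ^-homo-*; ^-assocʳ; ^-congˡ)
  open import Algebra.Properties.CommutativeSemiring.Exp commutativeSemiring using (^-distrib-*)
  open SetoidReasoning setoid

  infixr 8 _^ᴿ_
  _^ᴿ_ : Carrier → ℕ → Carrier
  _^ᴿ_ = _^'_ R

  ^ᴿ≈^ : ∀ x n → x ^ᴿ n ≈ x ^ n
  ^ᴿ≈^ x zero    = refl
  ^ᴿ≈^ x (suc n) = *-congˡ (^ᴿ≈^ x n)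

  ^ᴿ-congˡ : ∀ n {x y} → x ≈ y → x ^ᴿ n ≈ y ^ᴿ n
  ^ᴿ-congˡ n {x} {y} x≈y = trans (^ᴿ≈^ x n) (trans (^-congˡ n x≈y) (sym (^ᴿ≈^ y n)))

  ^ᴿ-congʳ : ∀ x {m n} → m ≡ n → x ^ᴿ m ≈ x ^ᴿ n
  ^ᴿ-congʳ x m≡n = reflexive (≡.cong (x ^ᴿ_) m≡n)

  ^ᴿ-homo-* : ∀ x m n → x ^ᴿ (m ℕ.+ n) ≈ x ^ᴿ m * x ^ᴿ n
  ^ᴿ-homo-* x m n = trans (^ᴿ≈^ x (m ℕ.+ n)) (trans (^-homo-* x m n) (sym (*-cong (^ᴿ≈^ x m) (^ᴿ≈^ x n))))

  ^ᴿ-assocʳ : ∀ x m n → (x ^ᴿ m) ^ᴿ n ≈ x ^ᴿ (m ℕ.* n)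
  ^ᴿ-assocʳ x m n = begin
    (x ^ᴿ m) ^ᴿ n   ≈⟨ trans (^ᴿ≈^ (x ^ᴿ m) n) (^-congˡ n (^ᴿ≈^ x m)) ⟩
    (x ^ m) ^ n     ≈⟨ ^-assocʳ x m n ⟩
    x ^ (m ℕ.* n)   ≈⟨ ^ᴿ≈^ x (m ℕ.* n) ⟨
    x ^ᴿ (m ℕ.* n)  ∎

  ^ᴿ-distrib-* : ∀ x y n → (x * y) ^ᴿ n ≈ x ^ᴿ n * y ^ᴿ n
  ^ᴿ-distrib-* x y n = trans (^ᴿ≈^ (x * y) n) (trans (^-distrib-* x y n) (sym (*-cong (^ᴿ≈^ x n) (^ᴿ≈^ y n))))

  1^ᴿ : ∀ n → 1# ^ᴿ n ≈ 1#
  1^ᴿ zero    = refl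
  1^ᴿ (suc n) = trans (*-identityˡ _) (1^ᴿ n)

  ^ᴿ-*-comm : ∀ x m n → (x ^ᴿ m) ^ᴿ n ≈ (x ^ᴿ n) ^ᴿ m
  ^ᴿ-*-comm x m n = trans (^ᴿ-assocʳ x m n) (trans (^ᴿ-congʳ x (ℕP.*-comm m n)) (sym (^ᴿ-assocʳ x n m)))

  x^ᴿm≈1⇒x^ᴿ[m*n]≈1 : ∀ {x} m n → x ^ᴿ m ≈ 1# → x ^ᴿ (m ℕ.* n) ≈ 1#
  x^ᴿm≈1⇒x^ᴿ[m*n]≈1 {x} m n x^m≈1 = trans (sym (^ᴿ-assocʳ x m n)) (trans (^ᴿ-congˡ n x^m≈1) (1^ᴿ n))

  IsMulOrd⇒∣ : ∀ {x d j} → IsMulOrd R x d → x ^ᴿ j ≈ 1# → d ∣ j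
  IsMulOrd⇒∣ {x} {d} {j} order = leastPos-divides {P = λ j → x ^ᴿ j ≈ 1#} cancel multiple order
    where
      cancel : ∀ i j → x ^ᴿ (i ℕ.+ j) ≈ 1# → x ^ᴿ i ≈ 1# → x ^ᴿ j ≈ 1#
      cancel i j x^[i+j]≈1 x^i≈1 = begin
        x ^ᴿ j                ≈⟨ *-identityˡ _ ⟨
        1# * x ^ᴿ j           ≈⟨ *-congʳ x^i≈1 ⟨
        x ^ᴿ i * x ^ᴿ j       ≈⟨ ^ᴿ-homo-* x i j ⟨
        x ^ᴿ (i ℕ.+ j)        ≈⟨ x^[i+j]≈1 ⟩
        1#                    ∎
      multiple : ∀ m i → x ^ᴿ i ≈ 1# → x ^ᴿ (m ℕ.* i) ≈ 1#
      multiple m i x^i≈1 = trans (^ᴿ-congʳ x (ℕP.*-comm m i)) (x^ᴿm≈1⇒x^ᴿ[m*n]≈1 i m x^i≈1)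

HasDegree-unique : ∀ {c ℓ} (R : CommutativeRing c ℓ) {f : Poly R} {k k′} → HasDegree R f k → HasDegree R f k′ → k ≡ k′
HasDegree-unique R {k = k} {k′} (fₖ≉0 , f-above) (fₖ′≉0 , f-above′) with ℕP.<-cmp k k′
... | tri< k<k′ _ _ = contradiction (f-above k′ k<k′) fₖ′≉0
... | tri≈ _ k≡k′ _ = k≡k′
... | tri> _ _ k>k′ = contradiction (f-above′ k k>k′) fₖ≉0

module FiniteField {c ℓ} (F : CommutativeRing c ℓ) (isField : IsField F)
                   (p : ℕ) (p-prime : Prime p) (K : ℕ) (card : HasCard F (p ℕ.^ K)) where

  open CommutativeRing F hiding (zero)
  open Powers F
  open Polynomial F
  open RingMorphisms rawRing rawRing using (IsRingHomomorphism; module IsRingHomomorphism)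
  open import Algebra.Properties.Ring ring using (-‿distribʳ-*)
  open import Algebra.Properties.Group +-group using (identityʳ-unique; inverseʳ-unique; x∙y⁻¹≈ε⇒x≈y; x≈y⇒x∙y⁻¹≈ε)
  open import Algebra.Definitions.RawMonoid +-rawMonoid using () renaming (_×_ to _·_)
  open import Algebra.Properties.Monoid.Sum +-monoid using (sum; sum-cong-≋; sum-init-last; sum-replicate; sum-replicate-zero)
  open import Algebra.Properties.CommutativeMonoid.Sum +-commutativeMonoid using (sum-permute; ∑-distrib-+)
  open import Algebra.Properties.Semiring.Mult semiring using (×1-homo-*; ×-assoc-*)
  open import Algebra.Properties.Semiring.Exp semiring using (_^_)
  open import Algebra.Properties.CommutativeSemiring.Binomial commutativeSemiring using (theorem; binomialTerm)

  instance _ = prime⇒nonZero p-prime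

  0≉1 : ¬ 0# ≈ 1#
  0≉1 = proj₁ isField

  enum : Fin (p ℕ.^ K) → Carrier
  enum = proj₁ card

  enum-injective : ∀ i j → enum i ≈ enum j → i ≡ j
  enum-injective = proj₁ (proj₂ card)

  index : Carrier → Fin (p ℕ.^ K)
  index x = proj₁ (proj₂ (proj₂ card) x)

  enum-index : ∀ x → enum (index x) ≈ x
  enum-index x = proj₂ (proj₂ (proj₂ card) x)

  infix 4 _≈?_
  _≈?_ : ∀ x y → Dec (x ≈ y)
  x ≈? y with index x Fin.≟ index y
  ... | yes i≡j = yes (trans (sym (enum-index x)) (trans (reflexive (≡.cong enum i≡j)) (enum-index y)))
  ... | no  i≢j = no λ x≈y → i≢j (enum-injective _ _ (trans (enum-index x) (trans x≈y (sym (enum-index y)))))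

  module _ where
    open SetoidReasoning setoid

    zero-product : ∀ {x y} → x * y ≈ 0# → x ≈ 0# ⊎ y ≈ 0#
    zero-product {x} {y} xy≈0 with x ≈? 0#
    ... | yes x≈0 = inj₁ x≈0
    ... | no  x≉0 with proj₂ isField x x≉0
    ... | x⁻¹ , xx⁻¹≈1 = inj₂ (begin
      y                ≈⟨ *-identityˡ y ⟨
      1# * y           ≈⟨ *-congʳ (trans (sym xx⁻¹≈1) (*-comm x x⁻¹)) ⟩
      (x⁻¹ * x) * y    ≈⟨ *-assoc x⁻¹ x y ⟩
      x⁻¹ * (x * y)    ≈⟨ *-congˡ xy≈0 ⟩
      x⁻¹ * 0#         ≈⟨ zeroʳ x⁻¹ ⟩
      0#               ∎)

    *-cancelˡ : ∀ {x y z} → ¬ x ≈ 0# → x * y ≈ x * z → y ≈ z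
    *-cancelˡ {x} {y} {z} x≉0 xy≈xz with zero-product {x} {y - z} (begin
      x * (y - z)        ≈⟨ distribˡ x y (- z) ⟩
      x * y + x * - z    ≈⟨ +-congˡ (sym (-‿distribʳ-* x z)) ⟩
      x * y - x * z      ≈⟨ x≈y⇒x∙y⁻¹≈ε xy≈xz ⟩
      0#                 ∎)
    ... | inj₁ x≈0   = contradiction x≈0 x≉0
    ... | inj₂ y-z≈0 = x∙y⁻¹≈ε⇒x≈y y z y-z≈0

    x^ᴿn≈0⇒x≈0 : ∀ {x} n → x ^ᴿ n ≈ 0# → x ≈ 0#
    x^ᴿn≈0⇒x≈0 zero    1≈0 = contradiction (sym 1≈0) 0≉1
    x^ᴿn≈0⇒x≈0 (suc n) e with zero-product e
    ... | inj₁ x≈0      = x≈0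
    ... | inj₂ x^ᴿn≈0   = x^ᴿn≈0⇒x≈0 n x^ᴿn≈0

    ^ᴿ≈1⇒≉0 : ∀ {x n} → 0 < n → x ^ᴿ n ≈ 1# → ¬ x ≈ 0#
    ^ᴿ≈1⇒≉0 {x} {suc n} _ x^n≈1 x≈0 = 0≉1 (begin
      0#             ≈⟨ zeroˡ _ ⟨
      0# * x ^ᴿ n    ≈⟨ *-congʳ x≈0 ⟨
      x ^ᴿ suc n     ≈⟨ x^n≈1 ⟩
      1#             ∎)

    -- Translation by 1# permutes the elements, so it leaves their sum unchanged.
    card·1≈0 : (p ℕ.^ K) · 1# ≈ 0#
    card·1≈0 = identityʳ-unique (sum enum) _ (begin
      sum enum + (p ℕ.^ K) · 1#        ≈⟨ +-congˡ (sum-replicate (p ℕ.^ K)) ⟨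
      sum enum + sum {p ℕ.^ K} (λ _ → 1#) ≈⟨ ∑-distrib-+ enum (λ _ → 1#) ⟨
      sum (λ i → enum i + 1#)          ≈⟨ sum-cong-≋ (λ i → sym (enum-index (enum i + 1#))) ⟩
      sum (enum ∘ next)                ≈⟨ sum-permute enum (permutation next prev next∘prev prev∘next) ⟨
      sum enum                         ∎)
      where
        next prev : Fin (p ℕ.^ K) → Fin (p ℕ.^ K)
        next i = index (enum i + 1#)
        prev i = index (enum i - 1#)
        next∘prev : ∀ i → next (prev i) ≡ i
        next∘prev i = enum-injective _ _ (begin
          enum (next (prev i))     ≈⟨ enum-index _ ⟩
          enum (prev i) + 1#       ≈⟨ +-congʳ (enum-index _) ⟩
          (enum i - 1#) + 1#       ≈⟨ +-assoc _ _ _ ⟩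
          enum i + (- 1# + 1#)     ≈⟨ +-congˡ (-‿inverseˡ 1#) ⟩
          enum i + 0#              ≈⟨ +-identityʳ _ ⟩
          enum i                   ∎)
        prev∘next : ∀ i → prev (next i) ≡ i
        prev∘next i = enum-injective _ _ (begin
          enum (prev (next i))     ≈⟨ enum-index _ ⟩
          enum (next i) - 1#       ≈⟨ +-congʳ (enum-index _) ⟩
          (enum i + 1#) - 1#       ≈⟨ +-assoc _ _ _ ⟩
          enum i + (1# - 1#)       ≈⟨ +-congˡ (-‿inverseʳ 1#) ⟩
          enum i + 0#              ≈⟨ +-identityʳ _ ⟩
          enum i                   ∎)

    p·1≈0 : p · 1# ≈ 0#
    p·1≈0 = x^ᴿn≈0⇒x≈0 K (trans (^ᴿ-power K) card·1≈0)
      where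
        ^ᴿ-power : ∀ k → (p · 1#) ^ᴿ k ≈ (p ℕ.^ k) · 1#
        ^ᴿ-power zero    = sym (+-identityʳ 1#)
        ^ᴿ-power (suc k) = trans (*-congˡ (^ᴿ-power k)) (sym (×1-homo-* p (p ℕ.^ k)))

    p∣n⇒n·x≈0 : ∀ {n} x → p ∣ n → n · x ≈ 0#
    p∣n⇒n·x≈0 x (divides m ≡.refl) = begin
      (m ℕ.* p) · x                   ≈⟨ ×-congʳ (m ℕ.* p) (*-identityˡ x) ⟨
      (m ℕ.* p) · (1# * x)            ≈⟨ ×-assoc-* (m ℕ.* p) 1# x ⟨
      ((m ℕ.* p) · 1#) * x            ≈⟨ *-congʳ (×1-homo-* m p) ⟩
      ((m · 1#) * (p · 1#)) * x       ≈⟨ *-congʳ (trans (*-congˡ p·1≈0) (zeroʳ _)) ⟩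
      0# * x                          ≈⟨ zeroˡ x ⟩
      0#                              ∎
      where open import Algebra.Properties.Monoid.Mult +-monoid using (×-congʳ)

    +-^-suc : ∀ n → (∀ k z → 0 ℕ.< k → k ℕ.< suc n → (suc n C k) · z ≈ 0#) →
              ∀ x y → (x + y) ^ suc n ≈ x ^ suc n + y ^ suc n
    +-^-suc n middle≈0 x y = begin
      (x + y) ^ suc n                                                     ≈⟨ theorem (suc n) x y ⟩
      term 0F + sum (term ∘ Fin.suc)                                      ≈⟨ +-congˡ (sum-init-last (term ∘ Fin.suc)) ⟩
      term 0F + (sum (init (term ∘ Fin.suc)) + last (term ∘ Fin.suc))     ≈⟨ +-cong first (+-cong (trans (sum-cong-≋ middle) (sum-replicate-zero n)) final) ⟩
      y ^ suc n + (0# + x ^ suc n)                                        ≈⟨ trans (+-congˡ (+-identityˡ _)) (+-comm _ _) ⟩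
      x ^ suc n + y ^ suc n                                               ∎
      where
        0F = Fin.zero
        term = binomialTerm x y (suc n)
        first : term 0F ≈ y ^ suc n
        first = trans (+-identityʳ _) (*-identityˡ _)
        final : last (term ∘ Fin.suc) ≈ x ^ suc n
        final = begin
          term (Fin.fromℕ (suc n))                                    ≡⟨ ≡.cong (λ k → (suc n C k) · (x ^ k * y ^ (suc n ℕ.∸ k))) (FinP.toℕ-fromℕ (suc n)) ⟩
          (suc n C suc n) · (x ^ suc n * y ^ (suc n ℕ.∸ suc n))      ≡⟨ ≡.cong₂ (λ a b → a · (x ^ suc n * y ^ b)) (nCn≡1 (suc n)) (ℕP.n∸n≡0 n) ⟩
          1 · (x ^ suc n * 1#)                                        ≈⟨ trans (+-identityʳ _) (*-identityʳ _) ⟩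
          x ^ suc n                                                   ∎
        middle : ∀ i → init (term ∘ Fin.suc) i ≈ 0#
        middle i = middle≈0 (suc (toℕ (Fin.inject₁ i))) _ (ℕ.s≤s ℕ.z≤n)
          (ℕ.s≤s (≡.subst (ℕ._< n) (≡.sym (FinP.toℕ-inject₁ i)) (FinP.toℕ<n i)))

    +-^ᴿp : ∀ x y → (x + y) ^ᴿ p ≈ x ^ᴿ p + y ^ᴿ p
    +-^ᴿp x y = begin
      (x + y) ^ᴿ p               ≈⟨ ^ᴿ-congʳ (x + y) p≡1+n ⟩
      (x + y) ^ᴿ suc n           ≈⟨ ^ᴿ≈^ (x + y) (suc n) ⟩
      (x + y) ^ suc n            ≈⟨ +-^-suc n middle≈0 x y ⟩
      x ^ suc n + y ^ suc n      ≈⟨ +-cong (^ᴿ≈^ x (suc n)) (^ᴿ≈^ y (suc n)) ⟨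
      x ^ᴿ suc n + y ^ᴿ suc n    ≈⟨ +-cong (^ᴿ-congʳ x p≡1+n) (^ᴿ-congʳ y p≡1+n) ⟨
      x ^ᴿ p + y ^ᴿ p            ∎
      where
        n = ℕ.pred p
        p≡1+n : p ≡ suc n
        p≡1+n = ≡.sym (ℕP.suc-pred p)
        middle≈0 : ∀ k z → 0 ℕ.< k → k ℕ.< suc n → (suc n C k) · z ≈ 0#
        middle≈0 k z 0<k k<1+n = p∣n⇒n·x≈0 z (≡.subst (λ m → p ∣ (m C k)) p≡1+n
          (prime∣pCk p-prime 0<k (≡.subst (k ℕ.<_) (≡.sym p≡1+n) k<1+n)))

    frobenius : ℕ → Carrier → Carrier
    frobenius j x = x ^ᴿ (p ℕ.^ j)

    frobenius-+ : ∀ j x y → frobenius j (x + y) ≈ frobenius j x + frobenius j y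
    frobenius-+ zero    x y = trans (*-identityʳ _) (+-cong (sym (*-identityʳ x)) (sym (*-identityʳ y)))
    frobenius-+ (suc j) x y = begin
      (x + y) ^ᴿ (p ℕ.* p ℕ.^ j)                      ≈⟨ ^ᴿ-assocʳ (x + y) p (p ℕ.^ j) ⟨
      ((x + y) ^ᴿ p) ^ᴿ (p ℕ.^ j)                     ≈⟨ ^ᴿ-congˡ (p ℕ.^ j) (+-^ᴿp x y) ⟩
      (x ^ᴿ p + y ^ᴿ p) ^ᴿ (p ℕ.^ j)                  ≈⟨ frobenius-+ j (x ^ᴿ p) (y ^ᴿ p) ⟩
      (x ^ᴿ p) ^ᴿ (p ℕ.^ j) + (y ^ᴿ p) ^ᴿ (p ℕ.^ j)    ≈⟨ +-cong (^ᴿ-assocʳ x p (p ℕ.^ j)) (^ᴿ-assocʳ y p (p ℕ.^ j)) ⟩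
      x ^ᴿ (p ℕ.* p ℕ.^ j) + y ^ᴿ (p ℕ.* p ℕ.^ j)      ∎

    frobenius-0# : ∀ j → frobenius j 0# ≈ 0#
    frobenius-0# j = trans (^ᴿ-congʳ 0# (≡.sym (ℕP.suc-pred (p ℕ.^ j)))) (zeroˡ _)
      where instance _ = ℕP.m^n≢0 p j

    frobenius-‿ : ∀ j x → frobenius j (- x) ≈ - frobenius j x
    frobenius-‿ j x = inverseʳ-unique _ _ (begin
      frobenius j x + frobenius j (- x)   ≈⟨ frobenius-+ j x (- x) ⟨
      frobenius j (x - x)                 ≈⟨ ^ᴿ-congˡ (p ℕ.^ j) (-‿inverseʳ x) ⟩
      frobenius j 0#                      ≈⟨ frobenius-0# j ⟩
      0#                                  ∎)

    frobenius-isRingHomomorphism : ∀ j → IsRingHomomorphism (frobenius j)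
    frobenius-isRingHomomorphism j = record
      { isSemiringHomomorphism = record
        { isNearSemiringHomomorphism = record
          { +-isMonoidHomomorphism = record
            { isMagmaHomomorphism = record
              { isRelHomomorphism = record { cong = ^ᴿ-congˡ (p ℕ.^ j) }
              ; homo = frobenius-+ j }
            ; ε-homo = frobenius-0# j }
          ; *-homo = λ x y → ^ᴿ-distrib-* x y (p ℕ.^ j) }
        ; 1#-homo = 1^ᴿ (p ℕ.^ j) }
      ; -‿homo = frobenius-‿ j }

    frobenius-injective : ∀ j {x y} → frobenius j x ≈ frobenius j y → x ≈ y
    frobenius-injective j {x} {y} e = x∙y⁻¹≈ε⇒x≈y x y (x^ᴿn≈0⇒x≈0 (p ℕ.^ j) (begin
      frobenius j (x - y)                   ≈⟨ frobenius-+ j x (- y) ⟩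
      frobenius j x + frobenius j (- y)     ≈⟨ +-congˡ (frobenius-‿ j y) ⟩
      frobenius j x - frobenius j y         ≈⟨ x≈y⇒x∙y⁻¹≈ε e ⟩
      0#                                    ∎))

  open IntegralDomain 0≉1 zero-product public

  x^ᴿn≉0 : ∀ {x} n → ¬ x ≈ 0# → ¬ x ^ᴿ n ≈ 0#
  x^ᴿn≉0 n x≉0 x^n≈0 = x≉0 (x^ᴿn≈0⇒x≈0 n x^n≈0)

  x^ᴿ[1+n]≈x⇔x^ᴿn≈1 : ∀ {x} n → ¬ x ≈ 0# → (x ^ᴿ suc n ≈ x ⇔ x ^ᴿ n ≈ 1#)
  x^ᴿ[1+n]≈x⇔x^ᴿn≈1 {x} n x≉0 = mk⇔
    (λ x^[1+n]≈x → *-cancelˡ x≉0 (trans x^[1+n]≈x (sym (*-identityʳ x))))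
    (λ x^n≈1 → trans (*-congˡ x^n≈1) (*-identityʳ x))

  frobenius≈^[p^a]^w : ∀ a w x → frobenius (a ℕ.* w) x ≈ x ^ᴿ (p ℕ.^ a) ℕ.^ w
  frobenius≈^[p^a]^w a w x = ^ᴿ-congʳ x (≡.sym (ℕP.^-*-assoc p a w))

  PolyOver⇔map-frobenius : ∀ a w g → PolyOver F ((p ℕ.^ a) ℕ.^ w) g ⇔ map (frobenius (a ℕ.* w)) g ≋ g
  PolyOver⇔map-frobenius a w g = mk⇔
    (λ g∈ → mk≋ λ i → trans (coeff-map g i) (trans (frobenius≈^[p^a]^w a w _) (g∈ i)))
    (λ fixed i → trans (sym (frobenius≈^[p^a]^w a w _)) (trans (sym (coeff-map g i)) (coeff-≈ fixed i)))
    where open Map (frobenius-isRingHomomorphism (a ℕ.* w))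

  module Conjugates (a : ℕ) (f : Poly F) {k : ℕ} (f-irreducible : IrreducibleOver F (p ℕ.^ a) f) (f-degree : HasDegree F f k)
                    (α : Carrier) (α-root : IsRoot F f α) (α≉0 : ¬ α ≈ 0#) where

    q : ℕ
    q = p ℕ.^ a

    InF-q⇒InF-q^i : ∀ {x} → InF F q x → ∀ i → x ^ᴿ (q ℕ.^ i) ≈ x
    InF-q⇒InF-q^i {x} x∈Fq zero    = *-identityʳ x
    InF-q⇒InF-q^i {x} x∈Fq (suc i) = begin
      x ^ᴿ (q ℕ.* q ℕ.^ i)    ≈⟨ ^ᴿ-assocʳ x q (q ℕ.^ i) ⟨
      (x ^ᴿ q) ^ᴿ (q ℕ.^ i)   ≈⟨ ^ᴿ-congˡ (q ℕ.^ i) x∈Fq ⟩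
      x ^ᴿ (q ℕ.^ i)          ≈⟨ InF-q⇒InF-q^i x∈Fq i ⟩
      x                       ∎
      where open SetoidReasoning setoid

    PolyOver-q⇒map-frobenius : ∀ g → PolyOver F q g → ∀ i → map (frobenius (a ℕ.* i)) g ≋ g
    PolyOver-q⇒map-frobenius g g∈Fq[x] i = Equivalence.to (PolyOver⇔map-frobenius a i g) λ j → InF-q⇒InF-q^i (g∈Fq[x] j) i

    conj : ℕ → Carrier
    conj i = α ^ᴿ (q ℕ.^ i)

    conj-0 : conj 0 ≈ α
    conj-0 = *-identityʳ α

    conj^q^i : ∀ d i → conj d ^ᴿ (q ℕ.^ i) ≈ conj (d ℕ.+ i)
    conj^q^i d i = trans (^ᴿ-assocʳ α (q ℕ.^ d) (q ℕ.^ i)) (^ᴿ-congʳ α (≡.sym (ℕP.^-distribˡ-+-* q d i)))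

    conj-root : ∀ i → eval F f (conj i) ≈ 0#
    conj-root i = begin
      eval F f (conj i)                          ≈⟨ eval-cong (conj i) (≋-sym (PolyOver-q⇒map-frobenius f (proj₁ f-irreducible) i)) ⟩
      eval F (map φ f) (conj i)                  ≈⟨ eval-congʳ (map φ f) (sym (frobenius≈^[p^a]^w a i α)) ⟩
      eval F (map φ f) (φ α)                     ≈⟨ eval-map f α ⟩
      φ (eval F f α)                             ≈⟨ ⟦⟧-cong α-root ⟩
      φ 0#                                       ≈⟨ 0#-homo ⟩
      0#                                         ∎
      where
        φ = frobenius (a ℕ.* i)
        open SetoidReasoning setoid
        open Map (frobenius-isRingHomomorphism (a ℕ.* i))
        open IsRingHomomorphism (frobenius-isRingHomomorphism (a ℕ.* i))

    conj-cancel : ∀ i d → conj (d ℕ.+ i) ≈ conj i → conj d ≈ α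
    conj-cancel i d e = frobenius-injective (a ℕ.* i) (begin
      frobenius (a ℕ.* i) (conj d)    ≈⟨ frobenius≈^[p^a]^w a i (conj d) ⟩
      conj d ^ᴿ (q ℕ.^ i)             ≈⟨ conj^q^i d i ⟩
      conj (d ℕ.+ i)                  ≈⟨ e ⟩
      conj i                          ≈⟨ frobenius≈^[p^a]^w a i α ⟨
      frobenius (a ℕ.* i) α           ∎)
      where open SetoidReasoning setoid

    conj-periodic : ∃ λ d → 0 < d × conj d ≈ α
    conj-periodic with FinP.pigeonhole (ℕP.n<1+n (p ℕ.^ K)) (index ∘ conj ∘ toℕ)
    ... | i , j , i<j , same-index = toℕ j ℕ.∸ toℕ i , ℕP.m<n⇒0<n∸m i<j , conj-cancel (toℕ i) (toℕ j ℕ.∸ toℕ i) (begin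
      conj (toℕ j ℕ.∸ toℕ i ℕ.+ toℕ i)   ≡⟨ ≡.cong conj (ℕP.m∸n+n≡m (ℕP.<⇒≤ i<j)) ⟩
      conj (toℕ j)                       ≈⟨ enum-index (conj (toℕ j)) ⟨
      enum (index (conj (toℕ j)))        ≡⟨ ≡.cong enum same-index ⟨
      enum (index (conj (toℕ i)))        ≈⟨ enum-index (conj (toℕ i)) ⟩
      conj (toℕ i)                       ∎)
      where open SetoidReasoning setoid

    -- abstract, so that the type checker never unfolds the search for the period
    abstract
      period : ∃ (IsLeastPos λ d → conj d ≈ α)
      period = let d , 0<d , conj-d≈α = conj-periodic in leastPos-exists (λ d → conj d ≈? α) 0<d conj-d≈α

    j₀ : ℕ
    j₀ = proj₁ period

    0<j₀ : 0 < j₀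
    0<j₀ = proj₁ (proj₂ period)

    conj-j₀ : conj j₀ ≈ α
    conj-j₀ = proj₁ (proj₂ (proj₂ period))

    conj-distinct : ∀ {i i′} → i < i′ → i′ < j₀ → ¬ conj i ≈ conj i′
    conj-distinct {i} {i′} i<i′ i′<j₀ e = ℕP.<⇒≱ (ℕP.≤-<-trans (ℕP.m∸n≤m i′ i) i′<j₀)
      (proj₂ (proj₂ (proj₂ period)) (i′ ℕ.∸ i) (ℕP.m<n⇒0<n∸m i<i′)
        (conj-cancel i (i′ ℕ.∸ i) (trans (reflexive (≡.cong conj (ℕP.m∸n+n≡m (ℕP.<⇒≤ i<i′)))) (sym e))))

    conj-product : ℕ → Poly F
    conj-product m = prodₚ F m (linear ∘ conj)

    -- Peel the distinct roots conj 0, …, conj (m - 1) off f one at a time.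
    conj-product-divides : ∀ m → m ≤ j₀ → ∃ λ h → f ≋ conj-product m *ₚ h × (∀ i → m ≤ i → i < j₀ → eval F h (conj i) ≈ 0#)
    conj-product-divides zero    _      = f , ≋-sym (*ₚ-identityˡ f) , λ i _ _ → conj-root i
    conj-product-divides (suc m) 1+m≤j₀ with conj-product-divides m (ℕP.<⇒≤ 1+m≤j₀)
    ... | h , f≋Πh , h-roots = quotient (conj m) h , f≋Π′h′ , h′-roots
      where
        h≋ : h ≋ linear (conj m) *ₚ quotient (conj m) h
        h≋ = factor-theorem (conj m) h (h-roots m ℕP.≤-refl 1+m≤j₀)
        f≋Π′h′ : f ≋ conj-product (suc m) *ₚ quotient (conj m) h
        f≋Π′h′ = begin
          f                                                                      ≈⟨ f≋Πh ⟩
          conj-product m *ₚ h                                                    ≈⟨ *ₚ-congˡ (conj-product m) h≋ ⟩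
          conj-product m *ₚ (linear (conj m) *ₚ quotient (conj m) h)             ≈⟨ *ₚ-assoc (conj-product m) _ _ ⟨
          (conj-product m *ₚ linear (conj m)) *ₚ quotient (conj m) h             ≈⟨ *ₚ-congʳ _ (prodₚ-sucʳ m (linear ∘ conj)) ⟨
          conj-product (suc m) *ₚ quotient (conj m) h                            ∎
          where open ≋-Reasoning
        h′-roots : ∀ i → suc m ≤ i → i < j₀ → eval F (quotient (conj m) h) (conj i) ≈ 0#
        h′-roots i 1+m≤i i<j₀ with zero-product (trans (sym (eval-*ₚ (linear (conj m)) (quotient (conj m) h) (conj i))) eval-factored-h≈0)
          where
            eval-factored-h≈0 : eval F (linear (conj m) *ₚ quotient (conj m) h) (conj i) ≈ 0#
            eval-factored-h≈0 = trans (eval-cong (conj i) (≋-sym h≋)) (h-roots i (ℕP.<⇒≤ 1+m≤i) i<j₀)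
        ... | inj₁ conjᵢ-conjₘ≈0 = contradiction (x∙y⁻¹≈ε⇒x≈y _ _ (trans (sym (eval-linear (conj m) (conj i))) conjᵢ-conjₘ≈0))
                                                 (conj-distinct 1+m≤i i<j₀ ∘ sym)
        ... | inj₂ h′-root       = h′-root

    module _ where
      φ-hom = frobenius-isRingHomomorphism (a ℕ.* 1)
      open Map φ-hom
      open ≋-Reasoning

      φ : Carrier → Carrier
      φ = frobenius (a ℕ.* 1)

      conj-suc : ∀ i → φ (conj i) ≈ conj (suc i)
      conj-suc i = trans (frobenius≈^[p^a]^w a 1 (conj i)) (trans (conj^q^i i 1) (reflexive (≡.cong conj (ℕP.+-comm i 1))))

      -- Frobenius shifts the conjugates cyclically, so it fixes their product.
      map-frobenius-conj-product : map φ (conj-product j₀) ≋ conj-product j₀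
      map-frobenius-conj-product = begin
        map φ (conj-product j₀)                  ≈⟨ map-prodₚ j₀ (linear ∘ conj) ⟩
        prodₚ F j₀ (map φ ∘ linear ∘ conj)       ≈⟨ prodₚ-cong j₀ (λ i _ → ≋-trans (map-linear φ-hom (conj i)) (linear-cong (conj-suc i))) ⟩
        prodₚ F j₀ (linear ∘ conj ∘ suc)         ≈⟨ prodₚ-rotate j₀ (linear ∘ conj) (linear-cong (trans conj-j₀ (sym conj-0))) ⟩
        conj-product j₀                          ∎

      abstract
        conj-product-factor : ∃ λ h → f ≋ conj-product j₀ *ₚ h
        conj-product-factor = let h , f≋g*h , _ = conj-product-divides j₀ ℕP.≤-refl in h , f≋g*h

      cofactor : Poly F
      cofactor = proj₁ conj-product-factor

      f≋conj-product*cofactor : f ≋ conj-product j₀ *ₚ cofactor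
      f≋conj-product*cofactor = proj₂ conj-product-factor

      map-frobenius-cofactor : map φ cofactor ≋ cofactor
      map-frobenius-cofactor = ≋-sym (-ₚ≋[]⇒≋ cofactor (map φ cofactor)
        (prodₚ-linear-*ₚ-cancel conj≉0 j₀ (cofactor -ₚ map φ cofactor) (begin
          g *ₚ (cofactor -ₚ map φ cofactor)              ≈⟨ *ₚ-distribˡ--ₚ g cofactor (map φ cofactor) ⟩
          g *ₚ cofactor -ₚ g *ₚ map φ cofactor           ≈⟨ -ₚ-cong (≋-sym f≋conj-product*cofactor) g*φh≋f ⟩
          f -ₚ f                                         ≈⟨ -ₚ-inverseʳ f ⟩
          []                                             ∎)))
        where
          g = conj-product j₀
          conj≉0 : ∀ i → ¬ conj i ≈ 0#
          conj≉0 i = x^ᴿn≉0 (q ℕ.^ i) α≉0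
          g*φh≋f : g *ₚ map φ cofactor ≋ f
          g*φh≋f = begin
            g *ₚ map φ cofactor               ≈⟨ *ₚ-congʳ (map φ cofactor) map-frobenius-conj-product ⟨
            map φ g *ₚ map φ cofactor         ≈⟨ map-*ₚ g cofactor ⟨
            map φ (g *ₚ cofactor)             ≈⟨ map-cong f≋conj-product*cofactor ⟨
            map φ f                           ≈⟨ PolyOver-q⇒map-frobenius f (proj₁ f-irreducible) 1 ⟩
            f                                 ∎

    PolyOver-q : ∀ g → map φ g ≋ g → PolyOver F q g
    PolyOver-q g fixed = ≡.subst (λ Q → PolyOver F Q g) (ℕP.*-identityʳ q) (Equivalence.from (PolyOver⇔map-frobenius a 1 g) fixed)

    -- Irreducibility forces the cofactor to be a nonzero constant, so deg f = j₀.
    degree≡period : k ≡ j₀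
    degree≡period with proj₂ (proj₂ f-irreducible) (conj-product j₀) cofactor
                         (PolyOver-q _ map-frobenius-conj-product) (PolyOver-q _ map-frobenius-cofactor)
                         (coeff-≈ f≋conj-product*cofactor)
    ... | inj₁ (_ , g-above-0) = contradiction (trans (sym (g-above-0 j₀ 0<j₀)) (prodₚ-linear-top conj j₀)) 0≉1
    ... | inj₂ (c≉0 , h-above-0) = HasDegree-unique F {f} f-degree (f-top≉0 , f-above)
      where
        c₀ = coeff F cofactor 0
        cofactor≋c₀ : cofactor ≋ const F c₀
        cofactor≋c₀ = mk≋ λ { zero → refl ; (suc i) → h-above-0 (suc i) (ℕ.s≤s ℕ.z≤n) }
        f≈c₀*g : ∀ i → coeff F f i ≈ c₀ * coeff F (conj-product j₀) i
        f≈c₀*g i = begin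
          coeff F f i                                       ≈⟨ coeff-≈ f≋conj-product*cofactor i ⟩
          coeff F (conj-product j₀ *ₚ cofactor) i           ≈⟨ coeff-≈ (*ₚ-congˡ (conj-product j₀) cofactor≋c₀) i ⟩
          coeff F (conj-product j₀ *ₚ const F c₀) i         ≈⟨ coeff-≈ (≋-trans (*ₚ-comm (conj-product j₀) (const F c₀)) (const-*ₚ c₀ (conj-product j₀))) i ⟩
          coeff F (scale F c₀ (conj-product j₀)) i          ≈⟨ coeff-scale c₀ (conj-product j₀) i ⟩
          c₀ * coeff F (conj-product j₀) i                  ∎
          where open SetoidReasoning setoid
        f-top≉0 : ¬ coeff F f j₀ ≈ 0#
        f-top≉0 fⱼ₀≈0 = c≉0 (trans (sym (trans (f≈c₀*g j₀) (trans (*-congˡ (prodₚ-linear-top conj j₀)) (*-identityʳ c₀)))) fⱼ₀≈0)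
        f-above : ∀ i → j₀ < i → coeff F f i ≈ 0#
        f-above i j₀<i = trans (f≈c₀*g i) (trans (*-congˡ (prodₚ-linear-above conj j₀ i j₀<i)) (zeroʳ c₀))

    α^q^k≈α : α ^ᴿ (q ℕ.^ k) ≈ α
    α^q^k≈α = trans (reflexive (≡.cong conj degree≡period)) conj-j₀


  module Gtu (a s k e d r t u : ℕ) .{{_ : NonZero t}} {α θ θ⁻¹ : Carrier}
           (0<k : 0 < k) (α^e≈1 : α ^ᴿ e ≈ 1#) (α^q^k≈α : α ^ᴿ (p ℕ.^ a) ℕ.^ k ≈ α)
           (θ-order : IsMulOrd F θ d) (θθ⁻¹≈1 : θ * θ⁻¹ ≈ 1#)
           (d⊥e : Coprime d e) (s⊥k : Coprime s k) where

    q : ℕ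
    q = p ℕ.^ a

    B : Carrier
    B = θ⁻¹ ^ᴿ u

    X : ℕ → ℕ
    X i = t ℕ.* r ℕ.* q ℕ.^ (i ℕ.* s)

    β : ℕ → Carrier
    β i = B * α ^ᴿ X i

    factor : ℕ → Poly F
    factor i = xpow F t -ₚ const F (β i)

    G : Poly F
    G = Gtu F q s k r t u α θ⁻¹

    θ^n*θ⁻¹^n≈1 : ∀ n → θ ^ᴿ n * θ⁻¹ ^ᴿ n ≈ 1#
    θ^n*θ⁻¹^n≈1 n = trans (sym (^ᴿ-distrib-* θ θ⁻¹ n)) (trans (^ᴿ-congˡ n θθ⁻¹≈1) (1^ᴿ n))

    θ⁻¹^n≈1⇔d∣n : ∀ n → θ⁻¹ ^ᴿ n ≈ 1# ⇔ d ∣ n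
    θ⁻¹^n≈1⇔d∣n n = mk⇔
      (λ θ⁻¹^n≈1 → IsMulOrd⇒∣ θ-order (trans (sym (*-identityʳ _)) (trans (*-congˡ (sym θ⁻¹^n≈1)) (θ^n*θ⁻¹^n≈1 n))))
      (λ { (divides m ≡.refl) → trans (^ᴿ-congʳ θ⁻¹ (ℕP.*-comm m d)) (x^ᴿm≈1⇒x^ᴿ[m*n]≈1 d m θ⁻¹^d≈1) })
      where
        θ⁻¹^d≈1 : θ⁻¹ ^ᴿ d ≈ 1#
        θ⁻¹^d≈1 = trans (sym (*-identityˡ _)) (trans (*-congʳ (sym (proj₁ (proj₂ θ-order)))) (θ^n*θ⁻¹^n≈1 d))

    θ⁻¹≉0 : ¬ θ⁻¹ ≈ 0#
    θ⁻¹≉0 θ⁻¹≈0 = 0≉1 (trans (sym (trans (*-congˡ θ⁻¹≈0) (zeroʳ θ))) θθ⁻¹≈1)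

    α^q^[k*j]≈α : ∀ j → α ^ᴿ q ℕ.^ (k ℕ.* j) ≈ α
    α^q^[k*j]≈α zero    = trans (^ᴿ-congʳ α (≡.cong (q ℕ.^_) (ℕP.*-zeroʳ k))) (*-identityʳ α)
    α^q^[k*j]≈α (suc j) = begin
      α ^ᴿ q ℕ.^ (k ℕ.* suc j)                ≡⟨ ≡.cong (λ z → α ^ᴿ q ℕ.^ z) (ℕP.*-suc k j) ⟩
      α ^ᴿ q ℕ.^ (k ℕ.+ k ℕ.* j)              ≡⟨ ≡.cong (α ^ᴿ_) (ℕP.^-distribˡ-+-* q k (k ℕ.* j)) ⟩
      α ^ᴿ (q ℕ.^ k ℕ.* q ℕ.^ (k ℕ.* j))      ≈⟨ ^ᴿ-assocʳ α (q ℕ.^ k) (q ℕ.^ (k ℕ.* j)) ⟨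
      (α ^ᴿ q ℕ.^ k) ^ᴿ q ℕ.^ (k ℕ.* j)       ≈⟨ ^ᴿ-congˡ (q ℕ.^ (k ℕ.* j)) α^q^k≈α ⟩
      α ^ᴿ q ℕ.^ (k ℕ.* j)                    ≈⟨ α^q^[k*j]≈α j ⟩
      α                                       ∎
      where open SetoidReasoning setoid

    α^[x*q^y]≈α^[x*q^y′] : ∀ x {y y′ j j′} → y ℕ.+ k ℕ.* j ≡ y′ ℕ.+ k ℕ.* j′ → α ^ᴿ (x ℕ.* q ℕ.^ y) ≈ α ^ᴿ (x ℕ.* q ℕ.^ y′)
    α^[x*q^y]≈α^[x*q^y′] x {y} {y′} {j} {j′} e = trans (sym (shift y j)) (trans (^ᴿ-congʳ α (≡.cong (λ z → x ℕ.* q ℕ.^ z) e)) (shift y′ j′))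
      where
        shift : ∀ y j → α ^ᴿ (x ℕ.* q ℕ.^ (y ℕ.+ k ℕ.* j)) ≈ α ^ᴿ (x ℕ.* q ℕ.^ y)
        shift y j = begin
          α ^ᴿ (x ℕ.* q ℕ.^ (y ℕ.+ k ℕ.* j))            ≡⟨ ≡.cong (λ z → α ^ᴿ (x ℕ.* z)) (ℕP.^-distribˡ-+-* q y (k ℕ.* j)) ⟩
          α ^ᴿ (x ℕ.* (q ℕ.^ y ℕ.* q ℕ.^ (k ℕ.* j)))    ≡⟨ ≡.cong (α ^ᴿ_) (ℕP.*-comm x _) ⟩
          α ^ᴿ ((q ℕ.^ y ℕ.* q ℕ.^ (k ℕ.* j)) ℕ.* x)    ≡⟨ ≡.cong (α ^ᴿ_) (≡.cong (ℕ._* x) (ℕP.*-comm (q ℕ.^ y) _)) ⟩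
          α ^ᴿ (q ℕ.^ (k ℕ.* j) ℕ.* q ℕ.^ y ℕ.* x)      ≡⟨ ≡.cong (α ^ᴿ_) (ℕP.*-assoc (q ℕ.^ (k ℕ.* j)) _ x) ⟩
          α ^ᴿ (q ℕ.^ (k ℕ.* j) ℕ.* (q ℕ.^ y ℕ.* x))    ≈⟨ ^ᴿ-assocʳ α (q ℕ.^ (k ℕ.* j)) _ ⟨
          (α ^ᴿ q ℕ.^ (k ℕ.* j)) ^ᴿ (q ℕ.^ y ℕ.* x)     ≈⟨ ^ᴿ-congˡ (q ℕ.^ y ℕ.* x) (α^q^[k*j]≈α j) ⟩
          α ^ᴿ (q ℕ.^ y ℕ.* x)                          ≡⟨ ≡.cong (α ^ᴿ_) (ℕP.*-comm (q ℕ.^ y) x) ⟩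
          α ^ᴿ (x ℕ.* q ℕ.^ y)                          ∎
          where open SetoidReasoning setoid

    [α^x]^e≈1 : ∀ x → (α ^ᴿ x) ^ᴿ e ≈ 1#
    [α^x]^e≈1 x = trans (^ᴿ-*-comm α x e) (trans (^ᴿ-congˡ x α^e≈1) (1^ᴿ x))

    B≉0 : ¬ B ≈ 0#
    B≉0 = x^ᴿn≉0 u θ⁻¹≉0

    B^[1+n]≈B⇔d∣u*n : ∀ n → B ^ᴿ suc n ≈ B ⇔ d ∣ u ℕ.* n
    B^[1+n]≈B⇔d∣u*n n = ⇔-trans (x^ᴿ[1+n]≈x⇔x^ᴿn≈1 n B≉0) (⇔-trans B^n≈1⇔θ⁻¹^[u*n]≈1 (θ⁻¹^n≈1⇔d∣n (u ℕ.* n)))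
      where
        B^n≈1⇔θ⁻¹^[u*n]≈1 : B ^ᴿ n ≈ 1# ⇔ θ⁻¹ ^ᴿ (u ℕ.* n) ≈ 1#
        B^n≈1⇔θ⁻¹^[u*n]≈1 = mk⇔ (trans (sym (^ᴿ-assocʳ θ⁻¹ u n))) (trans (^ᴿ-assocʳ θ⁻¹ u n))

    [B^e]^[1+n]≈B^e⇒d∣u*n : ∀ n → (B ^ᴿ e) ^ᴿ suc n ≈ B ^ᴿ e → d ∣ u ℕ.* n
    [B^e]^[1+n]≈B^e⇒d∣u*n n fixed = coprime-divisor d⊥e (≡.subst (d ∣_) u*e*n≡e*[u*n]
      (Equivalence.to (θ⁻¹^n≈1⇔d∣n (u ℕ.* e ℕ.* n)) (trans (sym (^ᴿ-assocʳ θ⁻¹ (u ℕ.* e) n))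
        (trans (^ᴿ-congˡ n (sym (^ᴿ-assocʳ θ⁻¹ u e))) (Equivalence.to (x^ᴿ[1+n]≈x⇔x^ᴿn≈1 n (x^ᴿn≉0 e B≉0)) fixed)))))
      where
        u*e*n≡e*[u*n] : u ℕ.* e ℕ.* n ≡ e ℕ.* (u ℕ.* n)
        u*e*n≡e*[u*n] = ≡.trans (≡.cong (ℕ._* n) (ℕP.*-comm u e)) (ℕP.*-assoc e u n)

    β^e≈B^e : ∀ i → β i ^ᴿ e ≈ B ^ᴿ e
    β^e≈B^e i = trans (^ᴿ-distrib-* B (α ^ᴿ X i) e) (trans (*-congˡ ([α^x]^e≈1 (X i))) (*-identityʳ _))

    root-product : Poly F
    root-product = prodₚ F k (linear ∘ β)

    open Stretch t

    G≋stretch-root-product : G ≋ stretch root-product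
    G≋stretch-root-product = ≋-sym (≋-trans (stretch-prodₚ k (linear ∘ β)) (prodₚ-cong k λ i _ → begin
      stretch (linear (β i))                           ≈⟨ stretch-cong (linear≋ (β i)) ⟨
      stretch (xpow F 1 -ₚ const F (β i))              ≈⟨ stretch--ₚ (xpow F 1) (const F (β i)) ⟩
      stretch (xpow F 1) -ₚ stretch (const F (β i))    ≈⟨ -ₚ-cong stretch-x (stretch-const (β i)) ⟩
      factor i                                         ∎))
      where open ≋-Reasoning

    root-product-β0 : eval F root-product (β 0) ≈ 0#
    root-product-β0 = begin
      eval F root-product (β 0)                                            ≡⟨ ≡.cong (λ n → eval F (prodₚ F n (linear ∘ β)) (β 0)) (ℕP.suc-pred k) ⟨
      eval F (prodₚ F (suc k′) (linear ∘ β)) (β 0)                         ≡⟨ ≡.cong (λ P → eval F P (β 0)) (prodₚ-suc k′ (linear ∘ β)) ⟩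
      eval F (linear (β 0) *ₚ prodₚ F k′ (linear ∘ β ∘ suc)) (β 0)         ≈⟨ eval-*ₚ (linear (β 0)) (prodₚ F k′ (linear ∘ β ∘ suc)) (β 0) ⟩
      eval F (linear (β 0)) (β 0) * eval F (prodₚ F k′ (linear ∘ β ∘ suc)) (β 0) ≈⟨ *-congʳ (trans (eval-linear (β 0) (β 0)) (-‿inverseʳ (β 0))) ⟩
      0# * eval F (prodₚ F k′ (linear ∘ β ∘ suc)) (β 0)                    ≈⟨ zeroˡ _ ⟩
      0#                                                                   ∎
      where
        open SetoidReasoning setoid
        k′ = ℕ.pred k
        instance _ = ℕ.>-nonZero 0<k

    module _ (w : ℕ) where
      open Map (frobenius-isRingHomomorphism (a ℕ.* w))
      open IsRingHomomorphism (frobenius-isRingHomomorphism (a ℕ.* w))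

      φ : Carrier → Carrier
      φ = frobenius (a ℕ.* w)

      Q′ : ℕ
      Q′ = q ℕ.^ w ℕ.∸ 1

      q^w≡1+Q′ : q ℕ.^ w ≡ suc Q′
      q^w≡1+Q′ = ≡.sym (ℕP.suc-pred (q ℕ.^ w) {{ℕP.m^n≢0 q w {{ℕP.m^n≢0 p a}}}})

      φ≈^[1+Q′] : ∀ x → φ x ≈ x ^ᴿ suc Q′
      φ≈^[1+Q′] x = trans (frobenius≈^[p^a]^w a w x) (^ᴿ-congʳ x q^w≡1+Q′)

      module Shift (c j j′ : ℕ) (c*s≡w : c ℕ.* s ℕ.+ k ℕ.* j ≡ w ℕ.+ k ℕ.* j′) where

        exponents : ∀ i → i ℕ.* s ℕ.+ w ℕ.+ k ℕ.* j′ ≡ (i ℕ.+ c) ℕ.* s ℕ.+ k ℕ.* j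
        exponents i = begin
          i ℕ.* s ℕ.+ w ℕ.+ k ℕ.* j′      ≡⟨ ℕP.+-assoc (i ℕ.* s) w _ ⟩
          i ℕ.* s ℕ.+ (w ℕ.+ k ℕ.* j′)    ≡⟨ ≡.cong (i ℕ.* s ℕ.+_) c*s≡w ⟨
          i ℕ.* s ℕ.+ (c ℕ.* s ℕ.+ k ℕ.* j) ≡⟨ ℕP.+-assoc (i ℕ.* s) _ _ ⟨
          i ℕ.* s ℕ.+ c ℕ.* s ℕ.+ k ℕ.* j ≡⟨ ≡.cong (ℕ._+ k ℕ.* j) (ℕP.*-distribʳ-+ s i c) ⟨
          (i ℕ.+ c) ℕ.* s ℕ.+ k ℕ.* j     ∎
          where open ≡.≡-Reasoning

        φ-β : φ B ≈ B → ∀ i → φ (β i) ≈ β (i ℕ.+ c)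
        φ-β φB≈B i = begin
          φ (B * α ^ᴿ X i)                                    ≈⟨ *-homo B _ ⟩
          φ B * φ (α ^ᴿ X i)                                  ≈⟨ *-cong φB≈B (frobenius≈^[p^a]^w a w (α ^ᴿ X i)) ⟩
          B * (α ^ᴿ X i) ^ᴿ q ℕ.^ w                           ≈⟨ *-congˡ (^ᴿ-assocʳ α (X i) (q ℕ.^ w)) ⟩
          B * α ^ᴿ (X i ℕ.* q ℕ.^ w)                          ≡⟨ ≡.cong (λ z → B * α ^ᴿ z) X*q^w≡ ⟩
          B * α ^ᴿ (t ℕ.* r ℕ.* q ℕ.^ (i ℕ.* s ℕ.+ w))        ≈⟨ *-congˡ (α^[x*q^y]≈α^[x*q^y′] (t ℕ.* r) (exponents i)) ⟩
          B * α ^ᴿ X (i ℕ.+ c)                                ∎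
          where
            open SetoidReasoning setoid
            X*q^w≡ : X i ℕ.* q ℕ.^ w ≡ t ℕ.* r ℕ.* q ℕ.^ (i ℕ.* s ℕ.+ w)
            X*q^w≡ = ≡.trans (ℕP.*-assoc (t ℕ.* r) _ _) (≡.cong (t ℕ.* r ℕ.*_) (≡.sym (ℕP.^-distribˡ-+-* q (i ℕ.* s) w)))

        map-φ-factor : φ B ≈ B → ∀ i → map φ (factor i) ≋ factor (i ℕ.+ c)
        map-φ-factor φB≈B i = ≋-trans (map--ₚ (xpow F t) (const F (β i))) (-ₚ-cong (map-xpow t) (∷-cong (φ-β φB≈B i) ≋-refl))

      factor-periodic : ∀ i → factor (i ℕ.+ k) ≋ factor i
      factor-periodic i = -ₚ-cong ≋-refl (∷-cong (*-congˡ (α^[x*q^y]≈α^[x*q^y′] (t ℕ.* r) exponents)) ≋-refl)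
        where
          exponents : (i ℕ.+ k) ℕ.* s ℕ.+ k ℕ.* 0 ≡ i ℕ.* s ℕ.+ k ℕ.* s
          exponents = ≡.trans (≡.cong ((i ℕ.+ k) ℕ.* s ℕ.+_) (ℕP.*-zeroʳ k)) (≡.trans (ℕP.+-identityʳ _) (ℕP.*-distribʳ-+ s i k))

      d∣⇒PolyOver-G : d ∣ u ℕ.* Q′ → PolyOver F (q ℕ.^ w) G
      d∣⇒PolyOver-G d∣u*Q′ with coprime⇒shift s⊥k 0<k w
      ... | c , j , j′ , c*s≡w = Equivalence.from (PolyOver⇔map-frobenius a w G) (begin
        map φ (prodₚ F k factor)                  ≈⟨ map-prodₚ k factor ⟩
        prodₚ F k (map φ ∘ factor)                ≈⟨ prodₚ-cong k (λ i _ → map-φ-factor φB≈B i) ⟩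
        prodₚ F k (λ i → factor (i ℕ.+ c))        ≈⟨ prodₚ-periodic-shift k factor factor-periodic c ⟩
        prodₚ F k factor                          ∎)
        where
          open ≋-Reasoning
          open Shift c j j′ c*s≡w
          φB≈B : φ B ≈ B
          φB≈B = trans (φ≈^[1+Q′] B) (Equivalence.from (B^[1+n]≈B⇔d∣u*n Q′) d∣u*Q′)

      PolyOver-G⇒PolyOver-root-product : PolyOver F (q ℕ.^ w) G → PolyOver F (q ℕ.^ w) root-product
      PolyOver-G⇒PolyOver-root-product G∈ j = trans (^ᴿ-congˡ (q ℕ.^ w) coeffⱼ) (trans (G∈ (t ℕ.* j)) (sym coeffⱼ))
        where
          coeffⱼ : coeff F root-product j ≈ coeff F G (t ℕ.* j)
          coeffⱼ = sym (trans (coeff-≈ G≋stretch-root-product (t ℕ.* j)) (coeff-stretch root-product j))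

      PolyOver-G⇒φβ₀≈β : PolyOver F (q ℕ.^ w) G → ∃ λ i → φ (β 0) ≈ β i
      PolyOver-G⇒φβ₀≈β G∈ = let i , _ , φβ₀-βᵢ≈0 = eval-prodₚ≈0 k (linear ∘ β) (φ (β 0)) root-product-φβ₀
                            in i , x∙y⁻¹≈ε⇒x≈y _ _ (trans (sym (eval-linear (β i) (φ (β 0)))) φβ₀-βᵢ≈0)
        where
          open SetoidReasoning setoid
          root-product-φβ₀ : eval F root-product (φ (β 0)) ≈ 0#
          root-product-φβ₀ = begin
            eval F root-product (φ (β 0))             ≈⟨ eval-cong (φ (β 0)) fixed ⟨
            eval F (map φ root-product) (φ (β 0))     ≈⟨ eval-map root-product (β 0) ⟩
            φ (eval F root-product (β 0))             ≈⟨ ⟦⟧-cong root-product-β0 ⟩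
            φ 0#                                      ≈⟨ 0#-homo ⟩
            0#                                        ∎
            where fixed = Equivalence.to (PolyOver⇔map-frobenius a w root-product) (PolyOver-G⇒PolyOver-root-product G∈)

      PolyOver-G⇒d∣ : PolyOver F (q ℕ.^ w) G → d ∣ u ℕ.* Q′
      PolyOver-G⇒d∣ G∈ = let i , φβ₀≈βᵢ = PolyOver-G⇒φβ₀≈β G∈ in [B^e]^[1+n]≈B^e⇒d∣u*n Q′ (begin
        (B ^ᴿ e) ^ᴿ suc Q′         ≈⟨ ^ᴿ-congˡ (suc Q′) (β^e≈B^e 0) ⟨
        (β 0 ^ᴿ e) ^ᴿ suc Q′       ≈⟨ ^ᴿ-*-comm (β 0) e (suc Q′) ⟩
        (β 0 ^ᴿ suc Q′) ^ᴿ e       ≈⟨ ^ᴿ-congˡ e (trans (sym (φ≈^[1+Q′] (β 0))) φβ₀≈βᵢ) ⟩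
        β i ^ᴿ e                   ≈⟨ β^e≈B^e i ⟩
        B ^ᴿ e                     ∎)
        where open SetoidReasoning setoid

      PolyOver-G⇔d∣ : PolyOver F (q ℕ.^ w) G ⇔ d ∣ u ℕ.* (q ℕ.^ w ℕ.∸ 1)
      PolyOver-G⇔d∣ = mk⇔ PolyOver-G⇒d∣ d∣⇒PolyOver-G

open import Data.Nat using (_*_; _^_; _∸_)

lemma3p5 : {c ℓ : Level}
    -- q = p^a a prime power
    (q p a : ℕ) → Prime p → 0 < a → q ≡ p ^ a →
    -- n positive, gcd(n,q) = 1, with s = s_n
    (n s : ℕ) → 0 < n → gcd n q ≡ 1 → Is-sn q n s → 1 < s →
    -- an ambient finite field L with q^N elements containing F_{q^s}
    (L : CommutativeRing c ℓ) → IsField L →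
    (N : ℕ) → HasCard L (q ^ N) → s ∣ N →
    -- f ∈ F_q[x] irreducible of degree k and order e
    (f : Poly L) (k e : ℕ) → IrreducibleOver L q f → HasDegree L f k →
    IsPolyOrder L q f e →
    gcd n (e * k) ≡ 1 → gcd s k ≡ 1 →
    -- d = gcd(n, q^s - 1), m = n / d
    (d m : ℕ) → d ≡ gcd n (q ^ s ∸ 1) → n ≡ m * d →
    -- r positive with r n ≡ 1 (mod e)
    (r : ℕ) → 0 < r → e ∣ (r * n ∸ 1) →
    -- α a root of f
    (α : CommutativeRing.Carrier L) → IsRoot L f α →
    -- θ ∈ F_{q^s}^* of multiplicative order d, with inverse θ⁻¹
    (θ θ⁻¹ : CommutativeRing.Carrier L) → InF L (q ^ s) θ → IsMulOrd L θ d → IsInverse L θ θ⁻¹ →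
    -- t a positive divisor of m, 1 ≤ u ≤ d, gcd(u,t) = 1
    (t u : ℕ) → 0 < t → t ∣ m → 1 ≤ u → u ≤ d → gcd u t ≡ 1 →
    ∀ v → IsLeastPos (λ w → PolyOver L (q ^ w) (Gtu L q s k r t u α θ⁻¹)) v
        ⇔ IsLeastPos (λ w → ∃ λ c' → d ≡ c' * gcd n (q ^ w ∸ 1) × c' ∣ u) v
-- Not needed: 0 < a, gcd(n, q) = 1, the facts about s_n and s ∣ N, m, r, θ ∈ F_{q^s}, t ∣ m and the conditions on u.
lemma3p5 .(p ^ a) p a p-prime _ ≡.refl n s 0<n _ _ _ L isField N card _ f k e f-irreducible f-degree f-order
         gcd[n,e*k]≡1 gcd[s,k]≡1 d _ d≡ _ r _ _ α α-root θ θ⁻¹ _ θ-order θθ⁻¹≈1 t u 0<t _ _ _ _ v =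
  ⇔-trans (leastPos-cong (λ w _ → PolyOver-G⇔d∣ w) v) (leastDiv⇔leastGcdForm v)
  where
    instance
      _ = ℕP.m^n≢0 p a {{prime⇒nonZero p-prime}}
      _ = ℕ.>-nonZero 0<t
    open CommutativeRing L using (_≈_; 1#)
    open Powers L using (_^ᴿ_)
    open Polynomial L using (mk≋; root-of-xᵉ-1)
    open GcdCriterion n (p ^ a) s d u 0<n d≡
    open FiniteField L isField p p-prime (a * N) (≡.subst (HasCard L) (ℕP.^-*-assoc p a N) card)

    0<k : 0 < k
    0<k = let k′ , 0<k′ , k′-degree = proj₁ (proj₂ f-irreducible)
          in ≡.subst (0 <_) (≡.sym (HasDegree-unique L {f} f-degree k′-degree)) 0<k′

    α^e≈1 : α ^ᴿ e ≈ 1#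
    α^e≈1 = let h , _ , xᵉ-1≈fh = proj₁ (proj₂ f-order) in root-of-xᵉ-1 {f} {h} e (mk≋ xᵉ-1≈fh) α-root

    open Conjugates a f f-irreducible f-degree α α-root (^ᴿ≈1⇒≉0 (proj₁ f-order) α^e≈1)

    d⊥e : Coprime d e
    d⊥e (i∣d , i∣e) = ∣1⇒≡1 (≡.subst (_ ∣_) gcd[n,e*k]≡1 (gcd-greatest (∣-trans i∣d d∣n) (∣m⇒∣m*n k i∣e)))

    open Gtu a s k e d r t u 0<k α^e≈1 α^q^k≈α θ-order θθ⁻¹≈1 d⊥e (gcd≡1⇒coprime gcd[s,k]≡1)
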